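{- (Squeezing lemma) Let $k\geq 2$, let $S$ be a rational $k$-simplex in $\mathbb R^n$, let $F$ be a $(k-1)$-dimensional face of $S$, and let $\eta\colon\mathbb R^n\to\mathbb R$ be an affine map with integer coefficients that is not constant on $F$. Then there is a non-surjective $\mathbb Z$-map $\rho\colon S\to S$ such that $\eta(\rho(x))=\eta(x)$ for all $x\in S$ and such that, for every $(k-1)$-dimensional face $G\neq F$ of $S$ and every $x\in G$, $\rho(x)=x$.
   Context: A rational $k$-simplex is the convex hull of $k+1$ affinely independent points of $\mathbb Q^n$ (its vertices); a face is the convex hull of a subset of its vertices. A $\mathbb Z$-map $\mathbb R^m\to\mathbb R^n$ is a continuous function that agrees at each point with one of finitely many affine maps with integer coefficients; a $\mathbb Z$-map $A\to B$ ($A\subseteq\mathbb R^m$, $B\subseteq\mathbb R^n$) is a restriction to $A$ of such a map with values in $B$.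
   Formalization: Stated over the rational points of ℝ^n: ρ is given by its values on ℚ^n, and $\eta(\rho(x))=\eta(x)$, the fixing of each face $G\neq F$, and non-surjectivity are checked at rational points only. -}

module Defs where

open import Data.Nat using (ℕ; zero; suc)
open import Data.Fin using (Fin; zero; suc)
open import Data.Integer using (ℤ)
open import Data.Rational using (ℚ; _+_; _*_; _-_; _/_; ∣_∣; _≤_; _<_; 0ℚ; 1ℚ)
open import Data.Product using (Σ; ∃; ∃-syntax; _×_; _,_)
open import Relation.Binary.PropositionalEquality using (_≡_)
open import Relation.Nullary using (¬_)

Pt : ℕ → Set
Pt n = Fin n → ℚ

_≋_ : ∀ {n} → Pt n → Pt n → Set
x ≋ y = ∀ i → x i ≡ y i

sumF : ∀ {m} → (Fin m → ℚ) → ℚ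
sumF {zero}  f = 0ℚ
sumF {suc m} f = f zero + sumF (λ i → f (suc i))

ℤ→ℚ : ℤ → ℚ
ℤ→ℚ z = z / 1

record AffZ (m n : ℕ) : Set where
  constructor affZ
  field
    mat : Fin n → Fin m → ℤ
    off : Fin n → ℤ

applyAffZ : ∀ {m n} → AffZ m n → Pt m → Pt n
applyAffZ (affZ A b) x i = sumF (λ j → ℤ→ℚ (A i j) * x j) + ℤ→ℚ (b i)

-- For maps ℚ^m → ℚ^n this
-- is exactly "extends (uniquely) to a continuous map ℝ^m → ℝ^n".
LocUnifCont : ∀ {m n} → (Pt m → Pt n) → Set
LocUnifCont {m} {n} f =
  ∀ (B ε : ℚ) → 0ℚ < ε → ∃[ δ ] (0ℚ < δ ×
    (∀ (x y : Pt m) → (∀ j → ∣ x j ∣ ≤ B) → (∀ j → ∣ y j ∣ ≤ B) →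
      (∀ j → ∣ x j - y j ∣ < δ) → ∀ i → ∣ f x i - f y i ∣ < ε))

-- These are precisely
-- the restrictions to ℚ^m of the ℤ-maps ℝ^m → ℝ^n of the paper.
record ZMap (m n : ℕ) : Set where
  field
    fun    : Pt m → Pt n
    pieces : ℕ
    piece  : Fin pieces → AffZ m n
    agrees : ∀ x → ∃[ p ] (fun x ≋ applyAffZ (piece p) x)
    cont   : LocUnifCont fun

comb : ∀ {k n} → (Fin (suc k) → Pt n) → (Fin (suc k) → ℚ) → Pt n
comb v λ' i = sumF (λ j → λ' j * v j i)

AffIndep : ∀ {k n} → (Fin (suc k) → Pt n) → Set
AffIndep {k} {n} v = ∀ (c : Fin (suc k) → ℚ) → sumF c ≡ 0ℚ →
  (∀ i → sumF (λ j → c j * v j i) ≡ 0ℚ) → ∀ j → c j ≡ 0ℚ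

record RSimplex (k n : ℕ) : Set where
  field
    vert  : Fin (suc k) → Pt n
    indep : AffIndep vert

IsBary : ∀ {k} → (Fin (suc k) → ℚ) → Set
IsBary c = (∀ j → 0ℚ ≤ c j) × sumF c ≡ 1ℚ

InS : ∀ {k n} → RSimplex k n → Pt n → Set
InS S x = ∃[ c ] (IsBary c × x ≋ comb (RSimplex.vert S) c)

-- x lies in the (k-1)-dimensional face of S opposite vertex v_i,
-- i.e. the convex hull of all vertices except v_i.  Every (k-1)-dimensional
-- face of S is of this form for exactly one i.
InFacet : ∀ {k n} → RSimplex k n → Fin (suc k) → Pt n → Set
InFacet S i x = ∃[ c ] (IsBary c × c i ≡ 0ℚ × x ≋ comb (RSimplex.vert S) c)

AffZ1 : ℕ → Set
AffZ1 n = AffZ n 1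

evalAffZ1 : ∀ {n} → AffZ1 n → Pt n → ℚ
evalAffZ1 η x = applyAffZ η x zero

-- A ℤ-map S → S: restriction of a ℤ-map ℚ^n → ℚ^n mapping S into S.
ZMapInto : ∀ {k n} → RSimplex k n → ZMap n n → Set
ZMapInto S ρ = ∀ x → InS S x → InS S (ZMap.fun ρ x)

SurjOnS : ∀ {k n} → RSimplex k n → ZMap n n → Set
SurjOnS S ρ = ∀ y → InS S y → ∃[ x ] (InS S x × ZMap.fun ρ x ≋ y)

-- The map is a shear ρ x = x + h(x) d along an integer direction d whose barycentric
-- coordinates μ sum to 0, are positive at the vertex f opposite F and are orthogonal to the
-- values of η at the vertices; so ρ preserves η and the affine hull of S.  The amount
-- h = max(0, min Λᵢ) is a truncated minimum of integer affine functions: Λ_g = N L_g - 1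
-- for the vertices g of F (L_g a barycentric coordinate, N clearing its denominators), and
-- the cap 1 - M (N L_r - 1).  On a facet G ≠ F some L_g vanishes, so h = 0 and ρ is the
-- identity there.  Where h > 0, the barycentric coordinates of x at the vertices of F are at
-- least (1 + h)/N while h ≤ 1/(1 + M), and M ≥ N ∣μ∣ then keeps ρ x in S.  Finally a point y
-- in the relative interior of F with all Λᵢ(y) > 0 has no preimage: a point moved by h > 0
-- gets a positive f-coordinate, and an unmoved point would be y itself, where h > 0.

module Submission where

open import Defs
open import Function using (_∘_)
open import Data.Empty using (⊥-elim)
open import Data.Bool using (if_then_else_; true; false)
open import Data.Product using (Σ-syntax; ∃-syntax; _×_; _,_; proj₁; proj₂; map₂)
open import Data.Sum using (_⊎_; inj₁; inj₂; [_,_]′)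
open import Relation.Nullary using (¬_; Dec; yes; no; does)
open import Relation.Binary.PropositionalEquality
open import Data.Nat as ℕ using (ℕ; zero; suc)
import Data.Nat.Properties as ℕP
import Data.Nat.Coprimality as Coprime
open import Data.Nat.Divisibility using (_∣_; divides)
import Data.Nat.Divisibility as Divisibility
open import Data.Nat.ListAction using (product)
open import Data.Nat.ListAction.Properties using (∈⇒∣product; product≢0)
import Data.List as List
open import Data.List.Membership.Propositional.Properties using (∈-tabulate⁺)
import Data.List.Relation.Unary.All.Properties as All
open import Data.Fin as Fin using (Fin; zero; suc; punchIn)
import Data.Fin.Properties as FinP
open import Data.Vec.Functional using (_∷_; [])
open import Data.Integer as ℤ using (ℤ)
import Data.Integer.Properties as ℤP
import Data.Integer.Tactic.RingSolver as ℤSolver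
open import Data.Rational as ℚ
  using (ℚ; mkℚ; 0ℚ; 1ℚ; _+_; _*_; _-_; -_; _≤_; _<_; ∣_∣; _⊔_; _⊓_; 1/_; ↧ₙ_; *≤*)
import Data.Rational.Properties as ℚP
import Data.Rational.Unnormalised as ℚᵘ
import Data.Rational.Unnormalised.Properties as ℚᵘP
open import Data.Rational.Solver using (module +-*-Solver)
open +-*-Solver using (solve; _:+_; _:*_; :-_; _:-_; con; _:=_)
open import Algebra.Bundles using (Ring)
open import Algebra.Properties.Group ℚP.+-0-group using (x∙y⁻¹≈ε⇒x≈y)
open import Algebra.Properties.Semiring.Sum (Ring.semiring ℚP.+-*-ring) as Sum using (sum)

-- Integers in ℚ

-- ℤ→ℚ z = z / 1 normalises through gcd, which does not compute on symbolic integers;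
-- fromℤ builds the normal form directly.
fromℤ : ℤ → ℚ
fromℤ z = mkℚ z 0 (Coprime.sym (Coprime.1-coprimeTo ℤ.∣ z ∣))

ℤ→ℚ≡fromℤ : ∀ z → ℤ→ℚ z ≡ fromℤ z
ℤ→ℚ≡fromℤ z = ℚP.↥p/↧p≡p (fromℤ z)

fromℕ : ℕ → ℚ
fromℕ n = fromℤ (ℤ.+ n)

IsInt : ℚ → Set
IsInt q = ∃[ z ] fromℤ z ≡ q

fromℤ-+ : ∀ a b → fromℤ (a ℤ.+ b) ≡ fromℤ a + fromℤ b
fromℤ-+ a b = begin
  fromℤ (a ℤ.+ b) ≡⟨ ℤ→ℚ≡fromℤ (a ℤ.+ b) ⟨
  ℤ→ℚ (a ℤ.+ b)   ≡⟨ ℚP./-cong (cong₂ ℤ._+_ (sym (ℤP.*-identityʳ a)) (sym (ℤP.*-identityʳ b))) refl ⟩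
  fromℤ a + fromℤ b ∎
  where open ≡-Reasoning

fromℤ-* : ∀ a b → fromℤ (a ℤ.* b) ≡ fromℤ a * fromℤ b
fromℤ-* a b = sym (ℤ→ℚ≡fromℤ (a ℤ.* b))

fromℤ-neg : ∀ a → fromℤ (ℤ.- a) ≡ - fromℤ a
fromℤ-neg (ℤ.+ zero)   = refl
fromℤ-neg (ℤ.+ suc n)  = refl
fromℤ-neg ℤ.-[1+ n ] = refl

fromℕ-mono-≤ : ∀ {m n} → m ℕ.≤ n → fromℕ m ≤ fromℕ n
fromℕ-mono-≤ {m} {n} m≤n =
  *≤* (subst₂ ℤ._≤_ (sym (ℤP.*-identityʳ (ℤ.+ m))) (sym (ℤP.*-identityʳ (ℤ.+ n))) (ℤ.+≤+ m≤n))

fromℕ-* : ∀ m n → fromℕ (m ℕ.* n) ≡ fromℕ m * fromℕ n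
fromℕ-* m n = trans (cong fromℤ (ℤP.pos-* m n)) (fromℤ-* (ℤ.+ m) (ℤ.+ n))

fromℕ-suc : ∀ n → fromℕ (suc n) ≡ 1ℚ + fromℕ n
fromℕ-suc n = fromℤ-+ (ℤ.+ 1) (ℤ.+ n)

1≤fromℕ : ∀ n .{{_ : ℕ.NonZero n}} → 1ℚ ≤ fromℕ n
1≤fromℕ (suc n) = fromℕ-mono-≤ {1} {suc n} (ℕ.s≤s ℕ.z≤n)

IsInt-ℤ : ∀ z → IsInt (fromℤ z)
IsInt-ℤ z = z , refl

IsInt-+ : ∀ {p q} → IsInt p → IsInt q → IsInt (p + q)
IsInt-+ (a , refl) (b , refl) = a ℤ.+ b , fromℤ-+ a b

IsInt-* : ∀ {p q} → IsInt p → IsInt q → IsInt (p * q)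
IsInt-* (a , refl) (b , refl) = a ℤ.* b , fromℤ-* a b

IsInt-neg : ∀ {p} → IsInt p → IsInt (- p)
IsInt-neg (a , refl) = ℤ.- a , fromℤ-neg a

IsInt-∣∣ : ∀ {p} → IsInt p → IsInt ∣ p ∣
IsInt-∣∣ (a , refl) = ℤ.+ ℤ.∣ a ∣ , refl

-- Finite sums

sumF≡sum : ∀ {m} (f : Fin m → ℚ) → sumF f ≡ sum f
sumF≡sum {zero}  f = refl
sumF≡sum {suc m} f = cong (f zero +_) (sumF≡sum (λ i → f (suc i)))

sumF-cong : ∀ {m} {f g : Fin m → ℚ} → (∀ i → f i ≡ g i) → sumF f ≡ sumF g
sumF-cong {f = f} {g} f≗g = begin
  sumF f ≡⟨ sumF≡sum f ⟩
  sum f  ≡⟨ Sum.sum-cong-≗ f≗g ⟩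
  sum g  ≡⟨ sumF≡sum g ⟨
  sumF g ∎
  where open ≡-Reasoning

sumF-+ : ∀ {m} (f g : Fin m → ℚ) → sumF (λ i → f i + g i) ≡ sumF f + sumF g
sumF-+ f g = begin
  sumF (λ i → f i + g i) ≡⟨ sumF≡sum (λ i → f i + g i) ⟩
  sum (λ i → f i + g i)  ≡⟨ Sum.∑-distrib-+ f g ⟩
  sum f + sum g          ≡⟨ cong₂ _+_ (sumF≡sum f) (sumF≡sum g) ⟨
  sumF f + sumF g        ∎
  where open ≡-Reasoning

sumF-*ˡ : ∀ {m} a (f : Fin m → ℚ) → sumF (λ i → a * f i) ≡ a * sumF f
sumF-*ˡ a f = begin
  sumF (λ i → a * f i) ≡⟨ sumF≡sum (λ i → a * f i) ⟩
  sum (λ i → a * f i)  ≡⟨ Sum.*-distribˡ-sum a f ⟨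
  a * sum f            ≡⟨ cong (a *_) (sumF≡sum f) ⟨
  a * sumF f           ∎
  where open ≡-Reasoning

sumF-*ʳ : ∀ {m} a (f : Fin m → ℚ) → sumF (λ i → f i * a) ≡ sumF f * a
sumF-*ʳ a f = begin
  sumF (λ i → f i * a) ≡⟨ sumF-cong (λ i → ℚP.*-comm (f i) a) ⟩
  sumF (λ i → a * f i) ≡⟨ sumF-*ˡ a f ⟩
  a * sumF f           ≡⟨ ℚP.*-comm a (sumF f) ⟩
  sumF f * a           ∎
  where open ≡-Reasoning

sumF-neg : ∀ {m} (f : Fin m → ℚ) → sumF (λ i → - f i) ≡ - sumF f
sumF-neg f = begin
  sumF (λ i → - f i)      ≡⟨ sumF-cong (λ i → neg≡-1* (f i)) ⟩
  sumF (λ i → - 1ℚ * f i) ≡⟨ sumF-*ˡ (- 1ℚ) f ⟩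
  - 1ℚ * sumF f           ≡⟨ neg≡-1* (sumF f) ⟨
  - sumF f                ∎
  where
  open ≡-Reasoning
  neg≡-1* : ∀ x → - x ≡ - 1ℚ * x
  neg≡-1* = solve 1 (λ x → :- x := :- con 1ℚ :* x) refl

sumF-- : ∀ {m} (f g : Fin m → ℚ) → sumF (λ i → f i - g i) ≡ sumF f - sumF g
sumF-- f g = trans (sumF-+ f (λ i → - g i)) (cong (sumF f +_) (sumF-neg g))

sumF-comm : ∀ {m p} (F : Fin m → Fin p → ℚ) →
  sumF (λ i → sumF (λ j → F i j)) ≡ sumF (λ j → sumF (λ i → F i j))
sumF-comm F = begin
  sumF (λ i → sumF (λ j → F i j)) ≡⟨ sumF-cong (λ i → sumF≡sum (F i)) ⟩
  sumF (λ i → sum (λ j → F i j))  ≡⟨ sumF≡sum (λ i → sum (F i)) ⟩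
  sum (λ i → sum (λ j → F i j))   ≡⟨ Sum.∑-comm F ⟩
  sum (λ j → sum (λ i → F i j))   ≡⟨ sumF≡sum (λ j → sum (λ i → F i j)) ⟨
  sumF (λ j → sum (λ i → F i j))  ≡⟨ sumF-cong (λ j → sumF≡sum (λ i → F i j)) ⟨
  sumF (λ j → sumF (λ i → F i j)) ∎
  where open ≡-Reasoning

sumF-remove : ∀ {m} i (f : Fin (suc m) → ℚ) → sumF f ≡ f i + sumF (λ t → f (punchIn i t))
sumF-remove i f = begin
  sumF f                             ≡⟨ sumF≡sum f ⟩
  sum f                              ≡⟨ Sum.sum-remove {i = i} f ⟩
  f i + sum (λ t → f (punchIn i t))  ≡⟨ cong (f i +_) (sumF≡sum (λ t → f (punchIn i t))) ⟨
  f i + sumF (λ t → f (punchIn i t)) ∎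
  where open ≡-Reasoning

sumF-zero : ∀ {m} → sumF {m} (λ _ → 0ℚ) ≡ 0ℚ
sumF-zero {m} = trans (sumF≡sum {m} (λ _ → 0ℚ)) (Sum.sum-replicate-zero m)

sumF-vanishes : ∀ {m} {f : Fin m → ℚ} → (∀ i → f i ≡ 0ℚ) → sumF f ≡ 0ℚ
sumF-vanishes {m} f≡0 = trans (sumF-cong f≡0) (sumF-zero {m})

sumF-const : ∀ {m} a → sumF {m} (λ _ → a) ≡ fromℕ m * a
sumF-const {zero}  a = sym (ℚP.*-zeroˡ a)
sumF-const {suc m} a = begin
  a + sumF {m} (λ _ → a)  ≡⟨ cong (a +_) (sumF-const {m} a) ⟩
  a + fromℕ m * a         ≡⟨ step a (fromℕ m) ⟩
  (1ℚ + fromℕ m) * a      ≡⟨ cong (_* a) (fromℕ-suc m) ⟨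
  fromℕ (suc m) * a       ∎
  where
  open ≡-Reasoning
  step : ∀ a n → a + n * a ≡ (1ℚ + n) * a
  step = solve 2 (λ a n → a :+ n :* a := (con 1ℚ :+ n) :* a) refl

sumF-mono-≤ : ∀ {m} {f g : Fin m → ℚ} → (∀ i → f i ≤ g i) → sumF f ≤ sumF g
sumF-mono-≤ {zero}  f≤g = ℚP.≤-refl
sumF-mono-≤ {suc m} f≤g = ℚP.+-mono-≤ (f≤g zero) (sumF-mono-≤ (λ i → f≤g (suc i)))

sumF-nonNeg : ∀ {m} {f : Fin m → ℚ} → (∀ i → 0ℚ ≤ f i) → 0ℚ ≤ sumF f
sumF-nonNeg {m} {f} 0≤f = subst (_≤ sumF f) (sumF-zero {m}) (sumF-mono-≤ 0≤f)

term≤sumF : ∀ {m} {f : Fin m → ℚ} → (∀ i → 0ℚ ≤ f i) → ∀ i → f i ≤ sumF f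
term≤sumF {suc m} {f} 0≤f i = begin
  f i                                ≡⟨ ℚP.+-identityʳ (f i) ⟨
  f i + 0ℚ                           ≤⟨ ℚP.+-monoʳ-≤ (f i) (sumF-nonNeg (λ t → 0≤f (punchIn i t))) ⟩
  f i + sumF (λ t → f (punchIn i t)) ≡⟨ sumF-remove i f ⟨
  sumF f                             ∎
  where open ℚP.≤-Reasoning

∣sumF∣≤sumF∣∣ : ∀ {m} (f : Fin m → ℚ) → ∣ sumF f ∣ ≤ sumF (λ i → ∣ f i ∣)
∣sumF∣≤sumF∣∣ {zero}  f = ℚP.≤-refl
∣sumF∣≤sumF∣∣ {suc m} f = ℚP.≤-trans (ℚP.∣p+q∣≤∣p∣+∣q∣ (f zero) _)
  (ℚP.+-monoʳ-≤ ∣ f zero ∣ (∣sumF∣≤sumF∣∣ (λ i → f (suc i))))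

IsInt-sumF : ∀ {m} {f : Fin m → ℚ} → (∀ i → IsInt (f i)) → IsInt (sumF f)
IsInt-sumF {zero}  _    = IsInt-ℤ (ℤ.+ 0)
IsInt-sumF {suc m} intf = IsInt-+ (intf zero) (IsInt-sumF (λ i → intf (suc i)))

-- Dual bases

δ : ∀ {m} → Fin m → Fin m → ℚ
δ i j = if does (i Fin.≟ j) then 1ℚ else 0ℚ

δ-diag : ∀ {m} (i : Fin m) → δ i i ≡ 1ℚ
δ-diag i with i Fin.≟ i
... | yes _   = refl
... | no i≢i = ⊥-elim (i≢i refl)

δ-off : ∀ {m} {i j : Fin m} → i ≢ j → δ i j ≡ 0ℚ
δ-off {i = i} {j} i≢j with i Fin.≟ j
... | yes i≡j = ⊥-elim (i≢j i≡j)
... | no _    = refl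

δ-sym : ∀ {m} (i j : Fin m) → δ i j ≡ δ j i
δ-sym i j with i Fin.≟ j | j Fin.≟ i
... | yes _   | yes _   = refl
... | no _    | no _    = refl
... | yes i≡j | no j≢i = ⊥-elim (j≢i (sym i≡j))
... | no i≢j | yes j≡i = ⊥-elim (i≢j (sym j≡i))

sumF-δ : ∀ {m} (f : Fin m → ℚ) i → sumF (λ j → f j * δ j i) ≡ f i
sumF-δ {suc m} f i = begin
  sumF (λ j → f j * δ j i)
    ≡⟨ sumF-remove i (λ j → f j * δ j i) ⟩
  f i * δ i i + sumF (λ t → f (punchIn i t) * δ (punchIn i t) i)
    ≡⟨ cong₂ _+_ (cong (f i *_) (δ-diag i))
                 (sumF-cong (λ t → cong (f (punchIn i t) *_) (δ-off (FinP.punchInᵢ≢i i t)))) ⟩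
  f i * 1ℚ + sumF (λ t → f (punchIn i t) * 0ℚ)
    ≡⟨ cong₂ _+_ (ℚP.*-identityʳ (f i)) (sumF-vanishes (λ t → ℚP.*-zeroʳ (f (punchIn i t)))) ⟩
  f i + 0ℚ
    ≡⟨ ℚP.+-identityʳ (f i) ⟩
  f i ∎
  where open ≡-Reasoning

sumF-δ′ : ∀ {m} (f : Fin m → ℚ) i → sumF (λ j → f j * δ i j) ≡ f i
sumF-δ′ f i = trans (sumF-cong (λ j → cong (f j *_) (δ-sym i j))) (sumF-δ f i)

dot : ∀ {N} → (Fin N → ℚ) → (Fin N → ℚ) → ℚ
dot a x = sumF (λ i → a i * x i)

lincomb : ∀ {m N} → (Fin m → ℚ) → (Fin m → Fin N → ℚ) → Fin N → ℚ
lincomb c w i = sumF (λ j → c j * w j i)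

dot-comm : ∀ {N} (a x : Fin N → ℚ) → dot a x ≡ dot x a
dot-comm a x = sumF-cong (λ i → ℚP.*-comm (a i) (x i))

dot-*ˡ : ∀ {N} t (a x : Fin N → ℚ) → dot (λ i → t * a i) x ≡ t * dot a x
dot-*ˡ t a x = trans (sumF-cong (λ i → ℚP.*-assoc t (a i) (x i))) (sumF-*ˡ t (λ i → a i * x i))

dot-δ : ∀ {N} i (x : Fin N → ℚ) → dot (δ i) x ≡ x i
dot-δ i x = trans (dot-comm (δ i) x) (sumF-δ′ x i)

dot-lincombʳ : ∀ {m N} (a : Fin N → ℚ) c (w : Fin m → Fin N → ℚ) →
  dot a (lincomb c w) ≡ dot c (λ j → dot a (w j))
dot-lincombʳ a c w = begin
  sumF (λ i → a i * sumF (λ j → c j * w j i))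
    ≡⟨ sumF-cong (λ i → sym (sumF-*ˡ (a i) (λ j → c j * w j i))) ⟩
  sumF (λ i → sumF (λ j → a i * (c j * w j i)))
    ≡⟨ sumF-comm (λ i j → a i * (c j * w j i)) ⟩
  sumF (λ j → sumF (λ i → a i * (c j * w j i)))
    ≡⟨ sumF-cong (λ j → trans (sumF-cong (λ i → exchange (a i) (c j) (w j i)))
                              (sumF-*ˡ (c j) (λ i → a i * w j i))) ⟩
  sumF (λ j → c j * sumF (λ i → a i * w j i)) ∎
  where
  open ≡-Reasoning
  exchange : ∀ a c w → a * (c * w) ≡ c * (a * w)
  exchange = solve 3 (λ a c w → a :* (c :* w) := c :* (a :* w)) refl

dot-lincombˡ : ∀ {m N} c (φ : Fin m → Fin N → ℚ) (x : Fin N → ℚ) →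
  dot (lincomb c φ) x ≡ dot c (λ g → dot (φ g) x)
dot-lincombˡ c φ x = begin
  dot (lincomb c φ) x          ≡⟨ dot-comm (lincomb c φ) x ⟩
  dot x (lincomb c φ)          ≡⟨ dot-lincombʳ x c φ ⟩
  dot c (λ g → dot x (φ g))    ≡⟨ sumF-cong (λ g → cong (c g *_) (dot-comm x (φ g))) ⟩
  dot c (λ g → dot (φ g) x)    ∎
  where open ≡-Reasoning

LinIndep : ∀ {m N} → (Fin m → Fin N → ℚ) → Set
LinIndep w = ∀ c → (∀ i → lincomb c w i ≡ 0ℚ) → ∀ j → c j ≡ 0ℚ

LinIndep-tail : ∀ {m N} (w : Fin (suc m) → Fin N → ℚ) → LinIndep w → LinIndep (λ j → w (suc j))
LinIndep-tail w indep c c⊥ j = indep (0ℚ ∷ c) head⊥ (suc j)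
  where
  head⊥ : ∀ i → 0ℚ * w zero i + lincomb c (λ j → w (suc j)) i ≡ 0ℚ
  head⊥ i = trans (cong (_+ lincomb c (λ j → w (suc j)) i) (ℚP.*-zeroˡ (w zero i)))
                  (trans (ℚP.+-identityˡ _) (c⊥ i))

-- A dual family φ′ of the tail w′ extends to w: the residual u = w₀ - Σ r_g w′_g of the
-- head is nonzero by independence, a coordinate functional scaled to be 1 on u and
-- corrected along φ′ gives ψ, which vanishes on w′ and is 1 on w₀, and φ′_g - r_g ψ
-- vanishes on w₀.
module DualExtension {m N} (w : Fin (suc m) → Fin N → ℚ) (indep : LinIndep w)
  (φ′ : Fin m → Fin N → ℚ) (φ′-spec : ∀ g j → dot (φ′ g) (w (suc j)) ≡ δ g j) where

  open ≡-Reasoning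

  w′ : Fin m → Fin N → ℚ
  w′ j = w (suc j)

  r : Fin m → ℚ
  r g = dot (φ′ g) (w zero)

  u : Fin N → ℚ
  u = lincomb (1ℚ ∷ λ g → - r g) w

  dot-u : ∀ a → dot a u ≡ 1ℚ * dot a (w zero) + dot (λ g → - r g) (λ g → dot a (w′ g))
  dot-u a = dot-lincombʳ a (1ℚ ∷ λ g → - r g) w

  cancel : ∀ x → 1ℚ * x + - x ≡ 0ℚ
  cancel = solve 1 (λ x → con 1ℚ :* x :+ :- x := con 0ℚ) refl

  φ′-u : ∀ h → dot (φ′ h) u ≡ 0ℚ
  φ′-u h = begin
    dot (φ′ h) u                                        ≡⟨ dot-u (φ′ h) ⟩
    1ℚ * r h + sumF (λ g → - r g * dot (φ′ h) (w′ g))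
      ≡⟨ cong (1ℚ * r h +_) (trans (sumF-cong (λ g → cong (- r g *_) (φ′-spec h g))) (sumF-δ′ (λ g → - r g) h)) ⟩
    1ℚ * r h + - r h                                    ≡⟨ cancel (r h) ⟩
    0ℚ                                                  ∎

  u≢0 : ∃[ i ] u i ≢ 0ℚ
  u≢0 = FinP.¬∀⟶∃¬ N (λ i → u i ≡ 0ℚ) (λ i → u i ℚP.≟ 0ℚ)
          (λ u≡0 → ℚP.1≢0 (indep (1ℚ ∷ λ g → - r g) u≡0 zero))

  i₀ : Fin N
  i₀ = proj₁ u≢0

  instance
    u-nonZero : ℚ.NonZero (u i₀)
    u-nonZero = ℚ.≢-nonZero (proj₂ u≢0)

  ψ₁ : Fin N → ℚ
  ψ₁ i = 1/ u i₀ * δ i₀ i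

  ψ₁-u : dot ψ₁ u ≡ 1ℚ
  ψ₁-u = trans (dot-*ˡ (1/ u i₀) (δ i₀) u) (trans (cong (1/ u i₀ *_) (dot-δ i₀ u)) (ℚP.*-inverseˡ (u i₀)))

  t : Fin m → ℚ
  t g = dot ψ₁ (w′ g)

  ψ : Fin N → ℚ
  ψ = lincomb (1ℚ ∷ λ g → - t g) (ψ₁ ∷ φ′)

  dot-ψ : ∀ x → dot ψ x ≡ 1ℚ * dot ψ₁ x + dot (λ g → - t g) (λ g → dot (φ′ g) x)
  dot-ψ x = dot-lincombˡ (1ℚ ∷ λ g → - t g) (ψ₁ ∷ φ′) x

  ψ-w′ : ∀ j → dot ψ (w′ j) ≡ 0ℚ
  ψ-w′ j = begin
    dot ψ (w′ j)                                        ≡⟨ dot-ψ (w′ j) ⟩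
    1ℚ * t j + sumF (λ g → - t g * dot (φ′ g) (w′ j))
      ≡⟨ cong (1ℚ * t j +_) (trans (sumF-cong (λ g → cong (- t g *_) (φ′-spec g j))) (sumF-δ (λ g → - t g) j)) ⟩
    1ℚ * t j + - t j                                    ≡⟨ cancel (t j) ⟩
    0ℚ                                                  ∎

  ψ-u : dot ψ u ≡ 1ℚ
  ψ-u = begin
    dot ψ u                                             ≡⟨ dot-ψ u ⟩
    1ℚ * dot ψ₁ u + sumF (λ g → - t g * dot (φ′ g) u)
      ≡⟨ cong₂ (λ a b → 1ℚ * a + b) ψ₁-u (sumF-vanishes (λ g → trans (cong (- t g *_) (φ′-u g)) (ℚP.*-zeroʳ (- t g)))) ⟩
    1ℚ * 1ℚ + 0ℚ                                        ≡⟨⟩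
    1ℚ                                                  ∎

  ψ-w₀ : dot ψ (w zero) ≡ 1ℚ
  ψ-w₀ = begin
    dot ψ (w zero)                                           ≡⟨ unit (dot ψ (w zero)) ⟨
    1ℚ * dot ψ (w zero) + 0ℚ
      ≡⟨ cong (1ℚ * dot ψ (w zero) +_) (sumF-vanishes (λ g → trans (cong (- r g *_) (ψ-w′ g)) (ℚP.*-zeroʳ (- r g)))) ⟨
    1ℚ * dot ψ (w zero) + sumF (λ g → - r g * dot ψ (w′ g))  ≡⟨ dot-u ψ ⟨
    dot ψ u                                                  ≡⟨ ψ-u ⟩
    1ℚ                                                       ∎
    where
    unit : ∀ x → 1ℚ * x + 0ℚ ≡ x
    unit = solve 1 (λ x → con 1ℚ :* x :+ con 0ℚ := x) refl

  φ : Fin (suc m) → Fin N → ℚ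
  φ zero    = ψ
  φ (suc h) = lincomb (1ℚ ∷ - r h ∷ []) (φ′ h ∷ ψ ∷ [])

  dot-φsuc : ∀ h x → dot (φ (suc h)) x ≡ 1ℚ * dot (φ′ h) x + (- r h * dot ψ x + 0ℚ)
  dot-φsuc h x = dot-lincombˡ (1ℚ ∷ - r h ∷ []) (φ′ h ∷ ψ ∷ []) x

  φ-spec : ∀ g j → dot (φ g) (w j) ≡ δ g j
  φ-spec zero    zero    = ψ-w₀
  φ-spec zero    (suc j) = ψ-w′ j
  φ-spec (suc h) zero    = trans (dot-φsuc h (w zero))
    (trans (cong (λ a → 1ℚ * r h + (- r h * a + 0ℚ)) ψ-w₀) (vanish (r h)))
    where
    vanish : ∀ x → 1ℚ * x + (- x * 1ℚ + 0ℚ) ≡ 0ℚ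
    vanish = solve 1 (λ x → con 1ℚ :* x :+ (:- x :* con 1ℚ :+ con 0ℚ) := con 0ℚ) refl
  φ-spec (suc h) (suc j) = trans (dot-φsuc h (w′ j))
    (trans (cong₂ (λ a b → 1ℚ * a + (- r h * b + 0ℚ)) (φ′-spec h j) (ψ-w′ j)) (keep (δ h j) (r h)))
    where
    keep : ∀ x y → 1ℚ * x + (- y * 0ℚ + 0ℚ) ≡ x
    keep = solve 2 (λ x y → con 1ℚ :* x :+ (:- y :* con 0ℚ :+ con 0ℚ) := x) refl

dualBasis : ∀ {m N} (w : Fin m → Fin N → ℚ) → LinIndep w →
  Σ[ φ ∈ (Fin m → Fin N → ℚ) ] (∀ g j → dot (φ g) (w j) ≡ δ g j)
dualBasis {zero}  w _     = (λ ()) , λ ()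
dualBasis {suc m} w indep with dualBasis (λ j → w (suc j)) (LinIndep-tail w indep)
... | φ′ , φ′-spec = DualExtension.φ w indep φ′ φ′-spec , DualExtension.φ-spec w indep φ′ φ′-spec

-- Affine functionals and barycentric coordinates

record AffQ (n : ℕ) : Set where
  constructor affQ
  field
    coeff  : Fin n → ℚ
    offset : ℚ

evalQ : ∀ {n} → AffQ n → Pt n → ℚ
evalQ (affQ a b) x = dot a x + b

-- evalQ (toAffQ η) and evalAffZ1 η agree definitionally.
toAffQ : ∀ {n} → AffZ1 n → AffQ n
toAffQ (affZ A b) = affQ (λ j → ℤ→ℚ (A zero j)) (ℤ→ℚ (b zero))

evalQ-cong : ∀ {n} (F : AffQ n) {x y} → x ≋ y → evalQ F x ≡ evalQ F y
evalQ-cong (affQ a b) x≋y = cong (_+ b) (sumF-cong (λ j → cong (a j *_) (x≋y j)))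

evalQ-translate : ∀ {n} (F : AffQ n) x d t →
  evalQ F (λ i → x i + t * d i) ≡ evalQ F x + t * dot (AffQ.coeff F) d
evalQ-translate (affQ a b) x d t = begin
  dot a (λ i → x i + t * d i) + b
    ≡⟨ cong (_+ b) (sumF-cong (λ i → ℚP.*-distribˡ-+ (a i) (x i) (t * d i))) ⟩
  sumF (λ i → a i * x i + a i * (t * d i)) + b
    ≡⟨ cong (_+ b) (sumF-+ (λ i → a i * x i) (λ i → a i * (t * d i))) ⟩
  dot a x + sumF (λ i → a i * (t * d i)) + b
    ≡⟨ cong (λ s → dot a x + s + b) (trans (sumF-cong (λ i → exchange (a i) t (d i))) (sumF-*ˡ t (λ i → a i * d i))) ⟩
  dot a x + t * dot a d + b
    ≡⟨ rearrange (dot a x) (t * dot a d) b ⟩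
  dot a x + b + t * dot a d ∎
  where
  open ≡-Reasoning
  exchange : ∀ a t d → a * (t * d) ≡ t * (a * d)
  exchange = solve 3 (λ a t d → a :* (t :* d) := t :* (a :* d)) refl
  rearrange : ∀ p q b → p + q + b ≡ p + b + q
  rearrange = solve 3 (λ p q b → p :+ q :+ b := p :+ b :+ q) refl

dot-evalQ-vertices : ∀ {k n} (F : AffQ n) (v : Fin (suc k) → Pt n) c →
  dot c (λ j → evalQ F (v j)) ≡ dot (AffQ.coeff F) (comb v c) + sumF c * AffQ.offset F
dot-evalQ-vertices (affQ a b) v c = begin
  dot c (λ j → dot a (v j) + b)
    ≡⟨ sumF-cong (λ j → ℚP.*-distribˡ-+ (c j) (dot a (v j)) b) ⟩
  sumF (λ j → c j * dot a (v j) + c j * b)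
    ≡⟨ sumF-+ (λ j → c j * dot a (v j)) (λ j → c j * b) ⟩
  dot c (λ j → dot a (v j)) + sumF (λ j → c j * b)
    ≡⟨ cong₂ _+_ (sym (dot-lincombʳ a c v)) (sumF-*ʳ b c) ⟩
  dot a (comb v c) + sumF c * b ∎
  where open ≡-Reasoning

evalQ-comb : ∀ {k n} (F : AffQ n) (v : Fin (suc k) → Pt n) c → sumF c ≡ 1ℚ →
  evalQ F (comb v c) ≡ dot c (λ j → evalQ F (v j))
evalQ-comb F v c Σc≡1 = sym (trans (dot-evalQ-vertices F v c)
  (cong (dot (AffQ.coeff F) (comb v c) +_) (trans (cong (_* AffQ.offset F) Σc≡1) (ℚP.*-identityˡ (AffQ.offset F)))))

coeff-comb-zeroSum : ∀ {k n} (F : AffQ n) (v : Fin (suc k) → Pt n) c → sumF c ≡ 0ℚ →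
  dot (AffQ.coeff F) (comb v c) ≡ dot c (λ j → evalQ F (v j))
coeff-comb-zeroSum F v c Σc≡0 = sym (trans (dot-evalQ-vertices F v c)
  (trans (cong (dot (AffQ.coeff F) (comb v c) +_) (trans (cong (_* AffQ.offset F) Σc≡0) (ℚP.*-zeroˡ (AffQ.offset F))))
         (ℚP.+-identityʳ _)))

comb-translate : ∀ {k n} (v : Fin (suc k) → Pt n) {x d : Pt n} c μ t →
  x ≋ comb v c → d ≋ comb v μ → (λ i → x i + t * d i) ≋ comb v (λ j → c j + t * μ j)
comb-translate v {x} {d} c μ t x≋ d≋ i = begin
  x i + t * d i                                   ≡⟨ cong₂ (λ p q → p + t * q) (x≋ i) (d≋ i) ⟩
  comb v c i + t * comb v μ i                     ≡⟨ cong (comb v c i +_) (sumF-*ˡ t (λ j → μ j * v j i)) ⟨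
  comb v c i + sumF (λ j → t * (μ j * v j i))     ≡⟨ sumF-+ (λ j → c j * v j i) (λ j → t * (μ j * v j i)) ⟨
  sumF (λ j → c j * v j i + t * (μ j * v j i))    ≡⟨ sumF-cong (λ j → collect (c j) t (μ j) (v j i)) ⟩
  comb v (λ j → c j + t * μ j) i                  ∎
  where
  open ≡-Reasoning
  collect : ∀ c t μ v → c * v + t * (μ * v) ≡ (c + t * μ) * v
  collect = solve 4 (λ c t μ v → c :* v :+ t :* (μ :* v) := (c :+ t :* μ) :* v) refl

punchIn-cover : ∀ {m} (i j : Fin (suc m)) → i ≡ j ⊎ ∃[ t ] punchIn i t ≡ j
punchIn-cover i j with i Fin.≟ j
... | yes i≡j = inj₁ i≡j
... | no i≢j  = inj₂ (Fin.punchOut i≢j , FinP.punchIn-punchOut i≢j)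

evalQ-const-on-facet : ∀ {k n} (S : RSimplex k n) f (F : AffQ n) a →
  (∀ t → evalQ F (RSimplex.vert S (punchIn f t)) ≡ a) → ∀ x → InFacet S f x → evalQ F x ≡ a
evalQ-const-on-facet {k} {n} S f F a F≡a x (c , (_ , Σc≡1) , c-f≡0 , x≋) = begin
  evalQ F x                           ≡⟨ evalQ-cong F x≋ ⟩
  evalQ F (comb v c)                  ≡⟨ evalQ-comb F v c Σc≡1 ⟩
  dot c (λ j → evalQ F (v j))         ≡⟨ sumF-cong termwise ⟩
  sumF (λ j → c j * a)                ≡⟨ sumF-*ʳ a c ⟩
  sumF c * a                          ≡⟨ cong (_* a) Σc≡1 ⟩
  1ℚ * a                              ≡⟨ ℚP.*-identityˡ a ⟩
  a                                   ∎
  where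
  open ≡-Reasoning
  v : Fin (suc k) → Pt n
  v = RSimplex.vert S
  termwise : ∀ j → c j * evalQ F (v j) ≡ c j * a
  termwise j with punchIn-cover f j
  ... | inj₁ refl     = begin
    c f * evalQ F (v f) ≡⟨ cong (_* evalQ F (v f)) c-f≡0 ⟩
    0ℚ * evalQ F (v f)  ≡⟨ ℚP.*-zeroˡ (evalQ F (v f)) ⟩
    0ℚ                  ≡⟨ ℚP.*-zeroˡ a ⟨
    0ℚ * a              ≡⟨ cong (_* a) c-f≡0 ⟨
    c f * a             ∎
  ... | inj₂ (t , refl) = cong (c (punchIn f t) *_) (F≡a t)

nonconstant-on-facet⇒vertices-differ : ∀ {k n} (S : RSimplex (suc k) n) f (F : AffQ n) →
  (∃[ x ] ∃[ y ] (InFacet S f x × InFacet S f y × evalQ F x ≢ evalQ F y)) →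
  ∃[ t ] evalQ F (RSimplex.vert S (punchIn f t)) ≢ evalQ F (RSimplex.vert S (punchIn f zero))
nonconstant-on-facet⇒vertices-differ {k} {n} S f F (x , y , x∈ , y∈ , Fx≢Fy) =
  FinP.¬∀⟶∃¬ (suc k) _ (λ t → evalQ F (v (punchIn f t)) ℚP.≟ a)
    (λ const → Fx≢Fy (trans (evalQ-const-on-facet S f F a const x x∈) (sym (evalQ-const-on-facet S f F a const y y∈))))
  where
  v : Fin (suc (suc k)) → Pt n
  v = RSimplex.vert S
  a : ℚ
  a = evalQ F (v (punchIn f zero))

module _ {k n} (S : RSimplex k n) where
  open RSimplex S renaming (vert to v; indep to v-indep)

  private
    homogenised : Fin (suc k) → Fin (suc n) → ℚ
    homogenised j = 1ℚ ∷ v j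

    homogenised-indep : LinIndep homogenised
    homogenised-indep c c⊥ =
      v-indep c (trans (sumF-cong (λ j → sym (ℚP.*-identityʳ (c j)))) (c⊥ zero)) (λ i → c⊥ (suc i))

    dual : Fin (suc k) → Fin (suc n) → ℚ
    dual = proj₁ (dualBasis homogenised homogenised-indep)

  -- Opaque, so that type checking never unfolds the dual basis.
  opaque
    baryCoord : Fin (suc k) → AffQ n
    baryCoord g = affQ (λ i → dual g (suc i)) (dual g zero)

    baryCoord-vert : ∀ g j → evalQ (baryCoord g) (v j) ≡ δ g j
    baryCoord-vert g j = begin
      dot (λ i → dual g (suc i)) (v j) + dual g zero
        ≡⟨ ℚP.+-comm _ (dual g zero) ⟩
      dual g zero + dot (λ i → dual g (suc i)) (v j)
        ≡⟨ cong (_+ dot (λ i → dual g (suc i)) (v j)) (ℚP.*-identityʳ (dual g zero)) ⟨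
      dot (dual g) (homogenised j)
        ≡⟨ proj₂ (dualBasis homogenised homogenised-indep) g j ⟩
      δ g j ∎
      where open ≡-Reasoning

  baryCoord-comb : ∀ g c → sumF c ≡ 1ℚ → ∀ x → x ≋ comb v c → evalQ (baryCoord g) x ≡ c g
  baryCoord-comb g c Σc≡1 x x≋ = begin
    evalQ (baryCoord g) x                      ≡⟨ evalQ-cong (baryCoord g) x≋ ⟩
    evalQ (baryCoord g) (comb v c)             ≡⟨ evalQ-comb (baryCoord g) v c Σc≡1 ⟩
    dot c (λ j → evalQ (baryCoord g) (v j))    ≡⟨ sumF-cong (λ j → cong (c j *_) (baryCoord-vert g j)) ⟩
    sumF (λ j → c j * δ g j)                   ≡⟨ sumF-δ′ c g ⟩
    c g                                        ∎
    where open ≡-Reasoning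

-- Integral affine functionals

IntegralAff : ∀ {n} → AffQ n → Set
IntegralAff (affQ a b) = (∀ j → IsInt (a j)) × IsInt b

infixr 7 _·ₐ_
infixl 6 _+ₐ_

_·ₐ_ : ∀ {n} → ℚ → AffQ n → AffQ n
t ·ₐ affQ a b = affQ (λ j → t * a j) (t * b)

_+ₐ_ : ∀ {n} → AffQ n → ℚ → AffQ n
affQ a b +ₐ q = affQ a (b + q)

evalQ-·ₐ : ∀ {n} t (F : AffQ n) x → evalQ (t ·ₐ F) x ≡ t * evalQ F x
evalQ-·ₐ t (affQ a b) x = begin
  dot (λ j → t * a j) x + t * b ≡⟨ cong (_+ t * b) (dot-*ˡ t a x) ⟩
  t * dot a x + t * b           ≡⟨ ℚP.*-distribˡ-+ t (dot a x) b ⟨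
  t * (dot a x + b)             ∎
  where open ≡-Reasoning

evalQ-+ₐ : ∀ {n} (F : AffQ n) q x → evalQ (F +ₐ q) x ≡ evalQ F x + q
evalQ-+ₐ (affQ a b) q x = sym (ℚP.+-assoc (dot a x) b q)

IntegralAff-·ₐ : ∀ {n} t (F : AffQ n) → IsInt t → IntegralAff F → IntegralAff (t ·ₐ F)
IntegralAff-·ₐ t (affQ a b) int-t (int-a , int-b) = (λ j → IsInt-* int-t (int-a j)) , IsInt-* int-t int-b

IntegralAff-+ₐ : ∀ {n} (F : AffQ n) q → IntegralAff F → IsInt q → IntegralAff (F +ₐ q)
IntegralAff-+ₐ (affQ a b) q (int-a , int-b) int-q = int-a , IsInt-+ int-b int-q

Clears : ℕ → ℚ → Set
Clears D q = IsInt (fromℕ D * q)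

↧ₙ-nonZero : ∀ q → ℕ.NonZero (↧ₙ q)
↧ₙ-nonZero (mkℚ _ _ _) = _

denominator-clears : ∀ q → Clears (↧ₙ q) q
denominator-clears q@(mkℚ n d-1 _) = n , sym
  (ℚP.toℚᵘ-injective (ℚᵘP.≃-trans (ℚP.toℚᵘ-homo-* (fromℕ (suc d-1)) q) (ℚᵘ.*≡* (cross (ℤ.+ suc d-1) n))))
  where
  cross : ∀ d n → (d ℤ.* n) ℤ.* ℤ.1ℤ ≡ n ℤ.* (ℤ.1ℤ ℤ.* d)
  cross = ℤSolver.solve-∀

clears-∣ : ∀ {D E} q → D ∣ E → Clears D q → Clears E q
clears-∣ {D} q (divides e refl) (z , z≡Dq) = ℤ.+ e ℤ.* z , (begin
  fromℤ (ℤ.+ e ℤ.* z)       ≡⟨ fromℤ-* (ℤ.+ e) z ⟩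
  fromℕ e * fromℤ z         ≡⟨ cong (fromℕ e *_) z≡Dq ⟩
  fromℕ e * (fromℕ D * q)   ≡⟨ ℚP.*-assoc (fromℕ e) (fromℕ D) q ⟨
  fromℕ e * fromℕ D * q     ≡⟨ cong (_* q) (fromℕ-* e D) ⟨
  fromℕ (e ℕ.* D) * q       ∎)
  where open ≡-Reasoning

∏ : ∀ {m} → (Fin m → ℕ) → ℕ
∏ D = product (List.tabulate D)

∣∏ : ∀ {m} (D : Fin m → ℕ) i → D i ∣ ∏ D
∣∏ D i = ∈⇒∣product (∈-tabulate⁺ i)

∏-nonZero : ∀ {m} (D : Fin m → ℕ) → (∀ i → ℕ.NonZero (D i)) → ℕ.NonZero (∏ D)
∏-nonZero D D≢0 = product≢0 (All.tabulate⁺ D≢0)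

commonDenominator : ∀ {m} → (Fin m → ℚ) → ℕ
commonDenominator q = ∏ (λ i → ↧ₙ q i)

commonDenominator-nonZero : ∀ {m} (q : Fin m → ℚ) → ℕ.NonZero (commonDenominator q)
commonDenominator-nonZero q = ∏-nonZero _ (λ i → ↧ₙ-nonZero (q i))

commonDenominator-clears : ∀ {m} (q : Fin m → ℚ) i → Clears (commonDenominator q) (q i)
commonDenominator-clears q i = clears-∣ (q i) (∣∏ (λ i → ↧ₙ q i) i) (denominator-clears (q i))

denominatorAff : ∀ {n} → AffQ n → ℕ
denominatorAff (affQ a b) = commonDenominator (b ∷ a)

denominatorAff-nonZero : ∀ {n} (F : AffQ n) → ℕ.NonZero (denominatorAff F)
denominatorAff-nonZero (affQ a b) = commonDenominator-nonZero (b ∷ a)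

IntegralAff-multiple : ∀ {n D} (F : AffQ n) → denominatorAff F ∣ D → IntegralAff (fromℕ D ·ₐ F)
IntegralAff-multiple (affQ a b) den∣D =
  (λ j → clears-∣ (a j) den∣D (commonDenominator-clears (b ∷ a) (suc j))) ,
  clears-∣ b den∣D (commonDenominator-clears (b ∷ a) zero)

-- Shears

δℤ : ∀ {n} → Fin n → Fin n → ℤ
δℤ i j = if does (i Fin.≟ j) then ℤ.1ℤ else ℤ.0ℤ

fromℤ-δℤ : ∀ {n} (i j : Fin n) → fromℤ (δℤ i j) ≡ δ i j
fromℤ-δℤ i j with does (i Fin.≟ j)
... | true  = refl
... | false = refl

shearPiece : ∀ {n} (F : AffQ n) → IntegralAff F → (d : Pt n) → (∀ i → IsInt (d i)) → AffZ n n
shearPiece (affQ a b) (int-a , int-b) d int-d =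
  affZ (λ i j → δℤ i j ℤ.+ proj₁ (int-d i) ℤ.* proj₁ (int-a j)) (λ i → proj₁ (int-d i) ℤ.* proj₁ int-b)

shearPiece-apply : ∀ {n} (F : AffQ n) intF d int-d x i →
  applyAffZ (shearPiece F intF d int-d) x i ≡ x i + evalQ F x * d i
shearPiece-apply (affQ a b) (int-a , int-b) d int-d x i = begin
  sumF (λ j → ℤ→ℚ (δℤ i j ℤ.+ proj₁ (int-d i) ℤ.* proj₁ (int-a j)) * x j) + ℤ→ℚ (proj₁ (int-d i) ℤ.* proj₁ int-b)
    ≡⟨ cong₂ _+_ (sumF-cong (λ j → cong (_* x j) (entry j)))
                 (trans (ℤ→ℚ≡fromℤ _) (trans (fromℤ-* (proj₁ (int-d i)) (proj₁ int-b))
                                              (cong₂ _*_ (proj₂ (int-d i)) (proj₂ int-b)))) ⟩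
  sumF (λ j → (δ i j + d i * a j) * x j) + d i * b
    ≡⟨ cong (_+ d i * b) (sumF-cong (λ j → split (δ i j) (d i) (a j) (x j))) ⟩
  sumF (λ j → δ i j * x j + d i * (a j * x j)) + d i * b
    ≡⟨ cong (_+ d i * b) (sumF-+ (λ j → δ i j * x j) (λ j → d i * (a j * x j))) ⟩
  dot (δ i) x + sumF (λ j → d i * (a j * x j)) + d i * b
    ≡⟨ cong₂ (λ p q → p + q + d i * b) (dot-δ i x) (sumF-*ˡ (d i) (λ j → a j * x j)) ⟩
  x i + d i * dot a x + d i * b
    ≡⟨ regroup (x i) (d i) (dot a x) b ⟩
  x i + (dot a x + b) * d i ∎
  where
  open ≡-Reasoning
  entry : ∀ j → ℤ→ℚ (δℤ i j ℤ.+ proj₁ (int-d i) ℤ.* proj₁ (int-a j)) ≡ δ i j + d i * a j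
  entry j = trans (ℤ→ℚ≡fromℤ _) (trans (fromℤ-+ (δℤ i j) (proj₁ (int-d i) ℤ.* proj₁ (int-a j)))
    (cong₂ _+_ (fromℤ-δℤ i j) (trans (fromℤ-* (proj₁ (int-d i)) (proj₁ (int-a j)))
                                     (cong₂ _*_ (proj₂ (int-d i)) (proj₂ (int-a j))))))
  split : ∀ e c a x → (e + c * a) * x ≡ e * x + c * (a * x)
  split = solve 4 (λ e c a x → (e :+ c :* a) :* x := e :* x :+ c :* (a :* x)) refl
  regroup : ∀ x c p b → x + c * p + c * b ≡ x + (p + b) * c
  regroup = solve 4 (λ x c p b → x :+ c :* p :+ c :* b := x :+ (p :+ b) :* c) refl

minF : ∀ {m} → (Fin (suc m) → ℚ) → ℚ
minF {zero}  e = e zero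
minF {suc m} e = e zero ⊓ minF (λ i → e (suc i))

minF-≤ : ∀ {m} (e : Fin (suc m) → ℚ) i → minF e ≤ e i
minF-≤ {zero}  e zero    = ℚP.≤-refl
minF-≤ {suc m} e zero    = ℚP.p⊓q≤p (e zero) _
minF-≤ {suc m} e (suc i) = ℚP.≤-trans (ℚP.p⊓q≤q (e zero) _) (minF-≤ (λ i → e (suc i)) i)

minF-sel : ∀ {m} (e : Fin (suc m) → ℚ) → ∃[ i ] minF e ≡ e i
minF-sel {zero}  e = zero , refl
minF-sel {suc m} e with ℚP.⊓-sel (e zero) (minF (λ i → e (suc i)))
... | inj₁ ≡e₀ = zero , ≡e₀
... | inj₂ ≡min with minF-sel (λ i → e (suc i))
...   | i , ≡eᵢ = suc i , trans ≡min ≡eᵢ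

hinge : ∀ {m n} → (Fin (suc m) → AffQ n) → Pt n → ℚ
hinge Λ x = 0ℚ ⊔ minF (λ i → evalQ (Λ i) x)

module _ {m n} (Λ : Fin (suc m) → AffQ n) (x : Pt n) where

  hinge-nonNeg : 0ℚ ≤ hinge Λ x
  hinge-nonNeg = ℚP.p≤p⊔q 0ℚ (minF (λ i → evalQ (Λ i) x))

  hinge-vanishes : ∀ i → evalQ (Λ i) x ≤ 0ℚ → hinge Λ x ≡ 0ℚ
  hinge-vanishes i Λᵢ≤0 = ℚP.p≥q⇒p⊔q≡p (ℚP.≤-trans (minF-≤ _ i) Λᵢ≤0)

  hinge-pos : (∀ i → 0ℚ < evalQ (Λ i) x) → 0ℚ < hinge Λ x
  hinge-pos Λ>0 with minF-sel (λ i → evalQ (Λ i) x)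
  ... | i , min≡Λᵢ =
    ℚP.<-≤-trans (subst (0ℚ <_) (sym min≡Λᵢ) (Λ>0 i)) (ℚP.p≤q⊔p 0ℚ (minF (λ i → evalQ (Λ i) x)))

  hinge-bounded : hinge Λ x ≡ 0ℚ ⊎ (∀ i → hinge Λ x ≤ evalQ (Λ i) x)
  hinge-bounded with ℚP.⊔-sel 0ℚ (minF (λ i → evalQ (Λ i) x))
  ... | inj₁ h≡0   = inj₁ h≡0
  ... | inj₂ h≡min = inj₂ (λ i → subst (_≤ _) (sym h≡min) (minF-≤ _ i))

  hinge-selects : hinge Λ x ≡ 0ℚ ⊎ ∃[ i ] hinge Λ x ≡ evalQ (Λ i) x
  hinge-selects with ℚP.⊔-sel 0ℚ (minF (λ i → evalQ (Λ i) x))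
  ... | inj₁ h≡0   = inj₁ h≡0
  ... | inj₂ h≡min = inj₂ (map₂ (trans h≡min) (minF-sel _))

shear : ∀ {m n} → (Fin (suc m) → AffQ n) → Pt n → Pt n → Pt n
shear Λ d x i = x i + hinge Λ x * d i

shear-unmoved : ∀ {m n} (Λ : Fin (suc m) → AffQ n) d x → hinge Λ x ≡ 0ℚ → shear Λ d x ≋ x
shear-unmoved Λ d x h≡0 a = begin
  x a + hinge Λ x * d a     ≡⟨ cong (λ h → x a + h * d a) h≡0 ⟩
  x a + 0ℚ * d a            ≡⟨ cong (x a +_) (ℚP.*-zeroˡ (d a)) ⟩
  x a + 0ℚ                  ≡⟨ ℚP.+-identityʳ (x a) ⟩
  x a                       ∎
  where open ≡-Reasoning

-- Lipschitz continuity

p≤∣p∣ : ∀ p → p ≤ ∣ p ∣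
p≤∣p∣ p with ℚP.≤-total 0ℚ p
... | inj₁ 0≤p = ℚP.≤-reflexive (sym (ℚP.0≤p⇒∣p∣≡p 0≤p))
... | inj₂ p≤0 = ℚP.≤-trans p≤0 (ℚP.0≤∣p∣ p)

neg-difference : ∀ p q → - (p - q) ≡ q - p
neg-difference = solve 2 (λ p q → :- (p :- q) := q :- p) refl

∣p-q∣≤-sym : ∀ {p q e} → ∣ p - q ∣ ≤ e → ∣ q - p ∣ ≤ e
∣p-q∣≤-sym {p} {q} {e} = subst (_≤ e) (trans (sym (ℚP.∣-p∣≡∣p∣ (p - q))) (cong ∣_∣ (neg-difference p q)))

∣p-q∣≤⇒p≤q+ : ∀ {p q e} → ∣ p - q ∣ ≤ e → p ≤ q + e
∣p-q∣≤⇒p≤q+ {p} {q} {e} ∣p-q∣≤e = begin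
  p               ≡⟨ shift p q ⟩
  q + (p - q)     ≤⟨ ℚP.+-monoʳ-≤ q (ℚP.≤-trans (p≤∣p∣ (p - q)) ∣p-q∣≤e) ⟩
  q + e           ∎
  where
  open ℚP.≤-Reasoning
  shift : ∀ p q → p ≡ q + (p - q)
  shift = solve 2 (λ p q → p := q :+ (p :- q)) refl

p≤q+e⇒p-q≤e : ∀ {p q e} → p ≤ q + e → p - q ≤ e
p≤q+e⇒p-q≤e {p} {q} {e} p≤q+e = subst (p - q ≤_) (cancel q e) (ℚP.+-monoˡ-≤ (- q) p≤q+e)
  where
  cancel : ∀ q e → q + e - q ≡ e
  cancel = solve 2 (λ q e → q :+ e :- q := e) refl

p≤q+⇒∣p-q∣≤ : ∀ {p q e} → p ≤ q + e → q ≤ p + e → ∣ p - q ∣ ≤ e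
p≤q+⇒∣p-q∣≤ {p} {q} {e} p≤q+e q≤p+e with ℚP.∣p∣≡p∨∣p∣≡-p (p - q)
... | inj₁ ∣p-q∣≡p-q    = subst (_≤ e) (sym ∣p-q∣≡p-q) (p≤q+e⇒p-q≤e p≤q+e)
... | inj₂ ∣p-q∣≡-[p-q] = subst (_≤ e) (sym (trans ∣p-q∣≡-[p-q] (neg-difference p q))) (p≤q+e⇒p-q≤e q≤p+e)

-- Both lattice operations commute with translation, so they preserve closeness.
⊔-close : ∀ {a a′ b b′ e} → ∣ a - a′ ∣ ≤ e → ∣ b - b′ ∣ ≤ e → ∣ (a ⊔ b) - (a′ ⊔ b′) ∣ ≤ e
⊔-close {a} {a′} {b} {b′} {e} a≈ b≈ =
  p≤q+⇒∣p-q∣≤ (bound a a′ b b′ a≈ b≈) (bound a′ a b′ b (∣p-q∣≤-sym {a} a≈) (∣p-q∣≤-sym {b} b≈))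
  where
  bound : ∀ p p′ q q′ → ∣ p - p′ ∣ ≤ e → ∣ q - q′ ∣ ≤ e → p ⊔ q ≤ (p′ ⊔ q′) + e
  bound p p′ q q′ p≈ q≈ = subst (p ⊔ q ≤_)
    (sym (ℚP.mono-≤-distrib-⊔ (ℚP.+-monoˡ-≤ e) p′ q′))
    (ℚP.⊔-mono-≤ (∣p-q∣≤⇒p≤q+ {p} {p′} p≈) (∣p-q∣≤⇒p≤q+ {q} {q′} q≈))

⊓-close : ∀ {a a′ b b′ e} → ∣ a - a′ ∣ ≤ e → ∣ b - b′ ∣ ≤ e → ∣ a ⊓ b - a′ ⊓ b′ ∣ ≤ e
⊓-close {a} {a′} {b} {b′} {e} a≈ b≈ =
  p≤q+⇒∣p-q∣≤ (bound a a′ b b′ a≈ b≈) (bound a′ a b′ b (∣p-q∣≤-sym {a} a≈) (∣p-q∣≤-sym {b} b≈))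
  where
  bound : ∀ p p′ q q′ → ∣ p - p′ ∣ ≤ e → ∣ q - q′ ∣ ≤ e → p ⊓ q ≤ p′ ⊓ q′ + e
  bound p p′ q q′ p≈ q≈ = subst (p ⊓ q ≤_)
    (sym (ℚP.mono-≤-distrib-⊓ (ℚP.+-monoˡ-≤ e) p′ q′))
    (ℚP.⊓-mono-≤ (∣p-q∣≤⇒p≤q+ {p} {p′} p≈) (∣p-q∣≤⇒p≤q+ {q} {q′} q≈))

0≤* : ∀ {p q} → 0ℚ ≤ p → 0ℚ ≤ q → 0ℚ ≤ p * q
0≤* {p} {q} 0≤p 0≤q = ℚP.nonNegative⁻¹ (p * q)
  {{ℚP.nonNeg*nonNeg⇒nonNeg p {{ℚ.nonNegative 0≤p}} q {{ℚ.nonNegative 0≤q}}}}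

0<* : ∀ {p q} → 0ℚ < p → 0ℚ < q → 0ℚ < p * q
0<* {p} {q} 0<p 0<q = ℚP.positive⁻¹ (p * q)
  {{ℚP.pos*pos⇒pos p {{ℚ.positive 0<p}} q {{ℚ.positive 0<q}}}}

positiveInverse : ∀ {p} → 0ℚ < p → ∃[ q ] (0ℚ < q × p * q ≡ 1ℚ)
positiveInverse {p} 0<p =
  1/ p , ℚP.positive⁻¹ (1/ p) {{ℚP.1/pos⇒pos p}} , ℚP.*-inverseʳ p
  where
  instance
    p-positive : ℚ.Positive p
    p-positive = ℚ.positive 0<p
    p-nonZero : ℚ.NonZero p
    p-nonZero = ℚP.pos⇒nonZero p

Lipschitz : ∀ {n} → ℚ → (Pt n → ℚ) → Set
Lipschitz L f = ∀ x y r → 0ℚ ≤ r → (∀ j → ∣ x j - y j ∣ ≤ r) → ∣ f x - f y ∣ ≤ L * r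

Lipschitz-weaken : ∀ {n L L′} {f : Pt n → ℚ} → L ≤ L′ → Lipschitz L f → Lipschitz L′ f
Lipschitz-weaken L≤L′ lip x y r 0≤r x≈y =
  ℚP.≤-trans (lip x y r 0≤r x≈y) (ℚP.*-monoʳ-≤-nonNeg r {{ℚ.nonNegative 0≤r}} L≤L′)

Lipschitz-const : ∀ {n L} q → 0ℚ ≤ L → Lipschitz {n} L (λ _ → q)
Lipschitz-const q 0≤L x y r 0≤r x≈y =
  subst (_≤ _) (cong ∣_∣ (sym (ℚP.+-inverseʳ q))) (0≤* 0≤L 0≤r)

⊔-Lipschitz : ∀ {n L} {f g : Pt n → ℚ} → Lipschitz L f → Lipschitz L g → Lipschitz L (λ x → f x ⊔ g x)
⊔-Lipschitz {f = f} {g} lip-f lip-g x y r 0≤r x≈y =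
  ⊔-close {f x} {f y} {g x} {g y} (lip-f x y r 0≤r x≈y) (lip-g x y r 0≤r x≈y)

⊓-Lipschitz : ∀ {n L} {f g : Pt n → ℚ} → Lipschitz L f → Lipschitz L g → Lipschitz L (λ x → f x ⊓ g x)
⊓-Lipschitz {f = f} {g} lip-f lip-g x y r 0≤r x≈y =
  ⊓-close {f x} {f y} {g x} {g y} (lip-f x y r 0≤r x≈y) (lip-g x y r 0≤r x≈y)

minF-Lipschitz : ∀ {m n L} {f : Fin (suc m) → Pt n → ℚ} →
  (∀ i → Lipschitz L (f i)) → Lipschitz L (λ x → minF (λ i → f i x))
minF-Lipschitz {zero}  lip = lip zero
minF-Lipschitz {suc m} {L = L} {f} lip =
  ⊓-Lipschitz {L = L} {f zero} {λ x → minF (λ i → f (suc i) x)}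
    (lip zero) (minF-Lipschitz {L = L} {f = λ i → f (suc i)} (λ i → lip (suc i)))

coeffNorm : ∀ {n} → AffQ n → ℚ
coeffNorm F = sumF (λ j → ∣ AffQ.coeff F j ∣)

coeffNorm-nonNeg : ∀ {n} (F : AffQ n) → 0ℚ ≤ coeffNorm F
coeffNorm-nonNeg F = sumF-nonNeg (λ j → ℚP.0≤∣p∣ (AffQ.coeff F j))

evalQ-Lipschitz : ∀ {n} (F : AffQ n) → Lipschitz (coeffNorm F) (evalQ F)
evalQ-Lipschitz (affQ a b) x y r 0≤r x≈y = begin
  ∣ dot a x + b - (dot a y + b) ∣          ≡⟨ cong ∣_∣ difference ⟩
  ∣ sumF (λ j → a j * (x j - y j)) ∣       ≤⟨ ∣sumF∣≤sumF∣∣ (λ j → a j * (x j - y j)) ⟩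
  sumF (λ j → ∣ a j * (x j - y j) ∣)       ≡⟨ sumF-cong (λ j → ℚP.∣p*q∣≡∣p∣*∣q∣ (a j) (x j - y j)) ⟩
  sumF (λ j → ∣ a j ∣ * ∣ x j - y j ∣)     ≤⟨ sumF-mono-≤ (λ j → ℚP.*-monoˡ-≤-nonNeg ∣ a j ∣ {{ℚP.∣-∣-nonNeg (a j)}}
                                                                 (x≈y j)) ⟩
  sumF (λ j → ∣ a j ∣ * r)                 ≡⟨ sumF-*ʳ r (λ j → ∣ a j ∣) ⟩
  sumF (λ j → ∣ a j ∣) * r                 ∎
  where
  open ℚP.≤-Reasoning
  cancel : ∀ p q b → p + b - (q + b) ≡ p - q
  cancel = solve 3 (λ p q b → p :+ b :- (q :+ b) := p :- q) refl
  pointwise : ∀ a x y → a * x - a * y ≡ a * (x - y)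
  pointwise = solve 3 (λ a x y → a :* x :- a :* y := a :* (x :- y)) refl
  difference : dot a x + b - (dot a y + b) ≡ sumF (λ j → a j * (x j - y j))
  difference = trans (cancel (dot a x) (dot a y) b)
    (trans (sym (sumF-- (λ j → a j * x j) (λ j → a j * y j)))
           (sumF-cong (λ j → pointwise (a j) (x j) (y j))))

Lipschitz⇒LocUnifCont : ∀ {m n} (f : Pt m → Pt n) L → 0ℚ ≤ L →
  (∀ i → Lipschitz L (λ x → f x i)) → LocUnifCont f
Lipschitz⇒LocUnifCont f L 0≤L lip B ε 0<ε = ε * c , 0<δ , close
  where
  inverse : ∃[ c ] (0ℚ < c × (1ℚ + L) * c ≡ 1ℚ)
  inverse = positiveInverse (ℚP.+-mono-<-≤ (ℚP.positive⁻¹ 1ℚ) 0≤L)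
  c : ℚ
  c = proj₁ inverse
  0<δ : 0ℚ < ε * c
  0<δ = 0<* 0<ε (proj₁ (proj₂ inverse))
  -- δ = ε c with (1 + L) c = 1, so that L δ + δ = ε.
  ε≡ : L * (ε * c) + ε * c ≡ ε
  ε≡ = trans (regroup L ε c) (trans (cong (ε *_) (proj₂ (proj₂ inverse))) (ℚP.*-identityʳ ε))
    where
    regroup : ∀ L ε c → L * (ε * c) + ε * c ≡ ε * ((1ℚ + L) * c)
    regroup = solve 3 (λ L ε c → L :* (ε :* c) :+ ε :* c := ε :* ((con 1ℚ :+ L) :* c)) refl
  close : ∀ x y → (∀ j → ∣ x j ∣ ≤ B) → (∀ j → ∣ y j ∣ ≤ B) →
    (∀ j → ∣ x j - y j ∣ < ε * c) → ∀ i → ∣ f x i - f y i ∣ < ε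
  close x y _ _ x≈y i = begin-strict
    ∣ f x i - f y i ∣         ≤⟨ lip i x y (ε * c) (ℚP.<⇒≤ 0<δ) (λ j → ℚP.<⇒≤ (x≈y j)) ⟩
    L * (ε * c)               ≡⟨ ℚP.+-identityʳ _ ⟨
    L * (ε * c) + 0ℚ          <⟨ ℚP.+-monoʳ-< (L * (ε * c)) 0<δ ⟩
    L * (ε * c) + ε * c       ≡⟨ ε≡ ⟩
    ε                         ∎
    where open ℚP.≤-Reasoning

slope : ∀ {m n} → (Fin m → AffQ n) → ℚ
slope Λ = sumF (λ i → coeffNorm (Λ i))

slope-nonNeg : ∀ {m n} (Λ : Fin m → AffQ n) → 0ℚ ≤ slope Λ
slope-nonNeg Λ = sumF-nonNeg (λ i → coeffNorm-nonNeg (Λ i))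

hinge-Lipschitz : ∀ {m n} (Λ : Fin (suc m) → AffQ n) → Lipschitz (slope Λ) (hinge Λ)
hinge-Lipschitz Λ =
  ⊔-Lipschitz {L = slope Λ} {f = λ _ → 0ℚ} {g = λ x → minF (λ i → evalQ (Λ i) x)}
    (Lipschitz-const 0ℚ (slope-nonNeg Λ))
    (minF-Lipschitz {L = slope Λ} {f = λ i → evalQ (Λ i)} (λ i →
      Lipschitz-weaken {L = coeffNorm (Λ i)} {f = evalQ (Λ i)}
        (term≤sumF {f = λ i → coeffNorm (Λ i)} (λ i → coeffNorm-nonNeg (Λ i)) i) (evalQ-Lipschitz (Λ i))))

shear-Lipschitz : ∀ {m n} (Λ : Fin (suc m) → AffQ n) (d : Pt n) i →
  Lipschitz (1ℚ + slope Λ * sumF (λ j → ∣ d j ∣)) (λ x → shear Λ d x i)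
shear-Lipschitz Λ d i x y r 0≤r x≈y = begin
  ∣ shear Λ d x i - shear Λ d y i ∣               ≡⟨ cong ∣_∣ (regroup (x i) (y i) (hinge Λ x) (hinge Λ y) (d i)) ⟩
  ∣ (x i - y i) + Δh * d i ∣                      ≤⟨ ℚP.∣p+q∣≤∣p∣+∣q∣ (x i - y i) (Δh * d i) ⟩
  ∣ x i - y i ∣ + ∣ Δh * d i ∣                    ≡⟨ cong (∣ x i - y i ∣ +_) (ℚP.∣p*q∣≡∣p∣*∣q∣ Δh (d i)) ⟩
  ∣ x i - y i ∣ + ∣ Δh ∣ * ∣ d i ∣                ≤⟨ ℚP.+-mono-≤ (x≈y i) hinge-step ⟩
  r + slope Λ * r * D                             ≡⟨ factor r (slope Λ) D ⟩
  (1ℚ + slope Λ * D) * r                          ∎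
  where
  open ℚP.≤-Reasoning
  Δh : ℚ
  Δh = hinge Λ x - hinge Λ y
  D : ℚ
  D = sumF (λ j → ∣ d j ∣)
  hinge-step : ∣ Δh ∣ * ∣ d i ∣ ≤ slope Λ * r * D
  hinge-step = ℚP.≤-trans
    (ℚP.*-monoʳ-≤-nonNeg ∣ d i ∣ {{ℚP.∣-∣-nonNeg (d i)}} (hinge-Lipschitz Λ x y r 0≤r x≈y))
    (ℚP.*-monoˡ-≤-nonNeg (slope Λ * r) {{ℚ.nonNegative (0≤* (slope-nonNeg Λ) 0≤r)}}
      (term≤sumF (λ j → ℚP.0≤∣p∣ (d j)) i))
  regroup : ∀ x y h h′ d → x + h * d - (y + h′ * d) ≡ (x - y) + (h - h′) * d
  regroup = solve 5 (λ x y h h′ d → x :+ h :* d :- (y :+ h′ :* d) := (x :- y) :+ (h :- h′) :* d) refl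
  factor : ∀ r L D → r + L * r * D ≡ (1ℚ + L * D) * r
  factor = solve 3 (λ r L D → r :+ L :* r :* D := (con 1ℚ :+ L :* D) :* r) refl

shearZMap : ∀ {m n} (Λ : Fin (suc m) → AffQ n) → (∀ i → IntegralAff (Λ i)) →
  (d : Pt n) → (∀ i → IsInt (d i)) → ZMap n n
shearZMap {m} {n} Λ int-Λ d int-d = record
  { fun    = shear Λ d
  ; pieces = suc (suc m)
  ; piece  = piece
  ; agrees = agrees
  ; cont   = Lipschitz⇒LocUnifCont (shear Λ d) _
               (ℚP.+-mono-≤ (ℚP.<⇒≤ (ℚP.positive⁻¹ 1ℚ))
                            (0≤* (slope-nonNeg Λ) (sumF-nonNeg (λ j → ℚP.0≤∣p∣ (d j)))))
               (shear-Lipschitz Λ d)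
  }
  where
  zeroAff : AffQ n
  zeroAff = affQ (λ _ → 0ℚ) 0ℚ

  evalQ-zeroAff : ∀ x → evalQ zeroAff x ≡ 0ℚ
  evalQ-zeroAff x = cong (_+ 0ℚ) (trans (sumF-cong (λ j → ℚP.*-zeroˡ (x j))) (sumF-zero {n}))

  zeroAff-integral : IntegralAff zeroAff
  zeroAff-integral = (λ _ → IsInt-ℤ ℤ.0ℤ) , IsInt-ℤ ℤ.0ℤ

  piece : Fin (suc (suc m)) → AffZ n n
  piece zero    = shearPiece zeroAff zeroAff-integral d int-d
  piece (suc i) = shearPiece (Λ i) (int-Λ i) d int-d

  agrees : ∀ x → ∃[ p ] (shear Λ d x ≋ applyAffZ (piece p) x)
  agrees x with hinge-selects Λ x
  ... | inj₁ h≡0 = zero , λ i →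
    trans (cong (λ h → x i + h * d i) (trans h≡0 (sym (evalQ-zeroAff x))))
          (sym (shearPiece-apply zeroAff zeroAff-integral d int-d x i))
  ... | inj₂ (j , h≡Λⱼ) = suc j , λ i →
    trans (cong (λ h → x i + h * d i) h≡Λⱼ) (sym (shearPiece-apply (Λ j) (int-Λ j) d int-d x i))

-- The squeezing map

0<1+[1+p] : ∀ {p} → 0ℚ ≤ p → 0ℚ < 1ℚ + (1ℚ + p)
0<1+[1+p] 0≤p = ℚP.+-mono-<-≤ (ℚP.positive⁻¹ 1ℚ) (ℚP.+-mono-≤ (ℚP.<⇒≤ (ℚP.positive⁻¹ 1ℚ)) 0≤p)

≤⇒0≤- : ∀ {p q} → p ≤ q → 0ℚ ≤ q - p
≤⇒0≤- {p} {q} p≤q = subst (_≤ q - p) (ℚP.+-inverseʳ p) (ℚP.+-monoˡ-≤ (- p) p≤q)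

0≤⇒0<⊎≡0 : ∀ {p} → 0ℚ ≤ p → 0ℚ < p ⊎ p ≡ 0ℚ
0≤⇒0<⊎≡0 {p} 0≤p with 0ℚ ℚP.<? p
... | yes 0<p = inj₁ 0<p
... | no 0≮p  = inj₂ (ℚP.≤-antisym (ℚP.≮⇒≥ 0≮p) 0≤p)

0<N*p⇒0<p : ∀ {N p} → 0ℚ < N → 0ℚ < N * p → 0ℚ < p
0<N*p⇒0<p {N} {p} 0<N 0<Np = ℚP.*-cancelˡ-<-nonNeg N {{ℚ.nonNegative (ℚP.<⇒≤ 0<N)}}
  (subst (_< N * p) (sym (ℚP.*-zeroʳ N)) 0<Np)

0≤N*p⇒0≤p : ∀ {N p} → 0ℚ < N → 0ℚ ≤ N * p → 0ℚ ≤ p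
0≤N*p⇒0≤p {N} {p} 0<N 0≤Np = ℚP.*-cancelˡ-≤-pos N {{ℚ.positive 0<N}}
  (subst (_≤ N * p) (sym (ℚP.*-zeroʳ N)) 0≤Np)

-- From h ≤ ℓ and h ≤ 1 - M ℓ we get (1 + M) h ≤ 1, and N c ≥ 1 + h; together with
-- N ∣ m ∣ ≤ M this leaves N (c + h m) ≥ 2 h ≥ 0.
squeeze-nonNeg : ∀ {N M c h m ℓ} → 0ℚ < N → N * ∣ m ∣ ≤ M → 0ℚ ≤ h →
  h ≤ N * c - 1ℚ → h ≤ ℓ → h ≤ - M * ℓ + 1ℚ → 0ℚ ≤ c + h * m
squeeze-nonNeg {N} {M} {c} {h} {m} {ℓ} 0<N N∣m∣≤M 0≤h h≤Nc-1 h≤ℓ h≤cap =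
  0≤N*p⇒0≤p 0<N (subst (0ℚ ≤_) (sym (split N M c h m ℓ))
    (ℚP.+-mono-≤ (≤⇒0≤- h≤Nc-1)
      (ℚP.+-mono-≤ (0≤* 0≤M (≤⇒0≤- h≤ℓ))
        (ℚP.+-mono-≤ (≤⇒0≤- h≤cap)
          (ℚP.+-mono-≤ (ℚP.+-mono-≤ 0≤h 0≤h) (0≤* 0≤h 0≤M+Nm))))))
  where
  0≤M : 0ℚ ≤ M
  0≤M = ℚP.≤-trans (0≤* (ℚP.<⇒≤ 0<N) (ℚP.0≤∣p∣ m)) N∣m∣≤M
  -m≤∣m∣ : - m ≤ ∣ m ∣
  -m≤∣m∣ = subst (- m ≤_) (ℚP.∣-p∣≡∣p∣ m) (p≤∣p∣ (- m))
  0≤M+Nm : 0ℚ ≤ M + N * m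
  0≤M+Nm = subst (0ℚ ≤_) (negate M N m)
    (≤⇒0≤- (ℚP.≤-trans (ℚP.*-monoˡ-≤-nonNeg N {{ℚ.nonNegative (ℚP.<⇒≤ 0<N)}} -m≤∣m∣) N∣m∣≤M))
    where
    negate : ∀ M N m → M - N * - m ≡ M + N * m
    negate = solve 3 (λ M N m → M :- N :* (:- m) := M :+ N :* m) refl
  split : ∀ N M c h m ℓ → N * (c + h * m) ≡
    (N * c - 1ℚ - h) + (M * (ℓ - h) + ((- M * ℓ + 1ℚ - h) + ((h + h) + h * (M + N * m))))
  split = solve 6 (λ N M c h m ℓ → N :* (c :+ h :* m) :=
    (N :* c :- con 1ℚ :- h) :+ (M :* (ℓ :- h) :+ ((:- M :* ℓ :+ con 1ℚ :- h) :+ ((h :+ h) :+ h :* (M :+ N :* m))))) refl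

-- γ = 1/(M + 1) is below both 1 and 1/M.
smallPositive : ∀ {M} → 0ℚ < M → ∃[ γ ] (0ℚ < γ × 0ℚ < - M * γ + 1ℚ × 0ℚ < 1ℚ - γ)
smallPositive {M} 0<M = γ , 0<γ , subst (0ℚ <_) (sym cap≡γ) 0<γ , subst (0ℚ <_) (sym 1-γ≡Mγ) (0<* 0<M 0<γ)
  where
  inverse : ∃[ γ ] (0ℚ < γ × (M + 1ℚ) * γ ≡ 1ℚ)
  inverse = positiveInverse (ℚP.+-mono-<-≤ 0<M (ℚP.<⇒≤ (ℚP.positive⁻¹ 1ℚ)))
  γ : ℚ
  γ = proj₁ inverse
  0<γ : 0ℚ < γ
  0<γ = proj₁ (proj₂ inverse)
  cap≡γ : - M * γ + 1ℚ ≡ γ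
  cap≡γ = trans (cong (- M * γ +_) (sym (proj₂ (proj₂ inverse)))) (simplify M γ)
    where
    simplify : ∀ M γ → - M * γ + (M + 1ℚ) * γ ≡ γ
    simplify = solve 2 (λ M γ → :- M :* γ :+ (M :+ con 1ℚ) :* γ := γ) refl
  1-γ≡Mγ : 1ℚ - γ ≡ M * γ
  1-γ≡Mγ = trans (cong (_- γ) (sym (proj₂ (proj₂ inverse)))) (simplify M γ)
    where
    simplify : ∀ M γ → (M + 1ℚ) * γ - γ ≡ M * γ
    simplify = solve 2 (λ M γ → (M :+ con 1ℚ) :* γ :- γ := M :* γ) refl

-- α = (1 + γ)/N once and β = (1 - α)/K₁ K₁ times sum to 1, with N α - 1 = γ and
-- K₁ (N β - 1) = (N - (2 + K₁)) + (1 - γ) > 0.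
interiorWeights : ∀ {N M K₁} → 0ℚ < M → 0ℚ < K₁ → 1ℚ + (1ℚ + K₁) ≤ N →
  ∃[ α ] ∃[ β ] (α + K₁ * β ≡ 1ℚ × 0ℚ < N * α - 1ℚ × 0ℚ < - M * (N * α - 1ℚ) + 1ℚ × 0ℚ < N * β - 1ℚ)
interiorWeights {N} {M} {K₁} 0<M 0<K₁ 2+K₁≤N =
  α , β , sum≡1 , subst (0ℚ <_) (sym Nα-1≡γ) 0<γ ,
  subst (λ z → 0ℚ < - M * z + 1ℚ) (sym Nα-1≡γ) 0<cap , 0<Nβ-1
  where
  open ≡-Reasoning
  small : ∃[ γ ] (0ℚ < γ × 0ℚ < - M * γ + 1ℚ × 0ℚ < 1ℚ - γ)
  small = smallPositive 0<M
  γ : ℚ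
  γ = proj₁ small
  0<γ : 0ℚ < γ
  0<γ = proj₁ (proj₂ small)
  0<cap : 0ℚ < - M * γ + 1ℚ
  0<cap = proj₁ (proj₂ (proj₂ small))
  N-inverse : ∃[ ν ] (0ℚ < ν × N * ν ≡ 1ℚ)
  N-inverse = positiveInverse (ℚP.<-≤-trans (0<1+[1+p] (ℚP.<⇒≤ 0<K₁)) 2+K₁≤N)
  K₁-inverse : ∃[ κ ] (0ℚ < κ × K₁ * κ ≡ 1ℚ)
  K₁-inverse = positiveInverse 0<K₁
  α β : ℚ
  α = (1ℚ + γ) * proj₁ N-inverse
  β = (1ℚ - α) * proj₁ K₁-inverse
  Nα-1≡γ : N * α - 1ℚ ≡ γ
  Nα-1≡γ = begin
    N * ((1ℚ + γ) * ν) - 1ℚ    ≡⟨ reorder N γ ν ⟩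
    (1ℚ + γ) * (N * ν) - 1ℚ    ≡⟨ cong (λ z → (1ℚ + γ) * z - 1ℚ) (proj₂ (proj₂ N-inverse)) ⟩
    (1ℚ + γ) * 1ℚ - 1ℚ         ≡⟨ simplify γ ⟩
    γ                          ∎
    where
    ν : ℚ
    ν = proj₁ N-inverse
    reorder : ∀ N γ ν → N * ((1ℚ + γ) * ν) - 1ℚ ≡ (1ℚ + γ) * (N * ν) - 1ℚ
    reorder = solve 3 (λ N γ ν → N :* ((con 1ℚ :+ γ) :* ν) :- con 1ℚ := (con 1ℚ :+ γ) :* (N :* ν) :- con 1ℚ) refl
    simplify : ∀ γ → (1ℚ + γ) * 1ℚ - 1ℚ ≡ γ
    simplify = solve 1 (λ γ → (con 1ℚ :+ γ) :* con 1ℚ :- con 1ℚ := γ) refl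
  sum≡1 : α + K₁ * β ≡ 1ℚ
  sum≡1 = begin
    α + K₁ * ((1ℚ - α) * κ)       ≡⟨ reorder α K₁ κ ⟩
    α + (1ℚ - α) * (K₁ * κ)       ≡⟨ cong (λ z → α + (1ℚ - α) * z) (proj₂ (proj₂ K₁-inverse)) ⟩
    α + (1ℚ - α) * 1ℚ             ≡⟨ simplify α ⟩
    1ℚ                            ∎
    where
    κ : ℚ
    κ = proj₁ K₁-inverse
    reorder : ∀ α K κ → α + K * ((1ℚ - α) * κ) ≡ α + (1ℚ - α) * (K * κ)
    reorder = solve 3 (λ α K κ → α :+ K :* ((con 1ℚ :- α) :* κ) := α :+ (con 1ℚ :- α) :* (K :* κ)) refl
    simplify : ∀ α → α + (1ℚ - α) * 1ℚ ≡ 1ℚ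
    simplify = solve 1 (λ α → α :+ (con 1ℚ :- α) :* con 1ℚ := con 1ℚ) refl
  K₁[Nβ-1] : K₁ * (N * β - 1ℚ) ≡ (N - (1ℚ + (1ℚ + K₁))) + (1ℚ - γ)
  K₁[Nβ-1] = begin
    K₁ * (N * ((1ℚ - α) * κ) - 1ℚ)                ≡⟨ reorder K₁ N α κ ⟩
    N * (1ℚ - α) * (K₁ * κ) - K₁                  ≡⟨ cong (λ z → N * (1ℚ - α) * z - K₁) (proj₂ (proj₂ K₁-inverse)) ⟩
    N * (1ℚ - α) * 1ℚ - K₁                        ≡⟨ expand N α K₁ ⟩
    (N - (1ℚ + (1ℚ + K₁))) + (1ℚ - (N * α - 1ℚ))  ≡⟨ cong (λ z → (N - (1ℚ + (1ℚ + K₁))) + (1ℚ - z)) Nα-1≡γ ⟩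
    (N - (1ℚ + (1ℚ + K₁))) + (1ℚ - γ)             ∎
    where
    κ : ℚ
    κ = proj₁ K₁-inverse
    reorder : ∀ K N α κ → K * (N * ((1ℚ - α) * κ) - 1ℚ) ≡ N * (1ℚ - α) * (K * κ) - K
    reorder = solve 4 (λ K N α κ → K :* (N :* ((con 1ℚ :- α) :* κ) :- con 1ℚ) := N :* (con 1ℚ :- α) :* (K :* κ) :- K) refl
    expand : ∀ N α K → N * (1ℚ - α) * 1ℚ - K ≡ (N - (1ℚ + (1ℚ + K))) + (1ℚ - (N * α - 1ℚ))
    expand = solve 3 (λ N α K → N :* (con 1ℚ :- α) :* con 1ℚ :- K :=
      (N :- (con 1ℚ :+ (con 1ℚ :+ K))) :+ (con 1ℚ :- (N :* α :- con 1ℚ))) refl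
  0<Nβ-1 : 0ℚ < N * β - 1ℚ
  0<Nβ-1 = 0<N*p⇒0<p 0<K₁ (subst (0ℚ <_) (sym K₁[Nβ-1])
    (ℚP.+-mono-≤-< (≤⇒0≤- 2+K₁≤N) (proj₂ (proj₂ (proj₂ small)))))

module Squeeze {k′ n} (S : RSimplex (suc (suc k′)) n) (f : Fin (suc (suc (suc k′)))) (η : AffQ n)
  (nonconstant : ∃[ t ] evalQ η (RSimplex.vert S (punchIn f t)) ≢ evalQ η (RSimplex.vert S (punchIn f zero)))
  where

  open ≡-Reasoning

  k : ℕ
  k = suc (suc k′)

  v : Fin (suc k) → Pt n
  v = RSimplex.vert S

  e : Fin (suc k) → ℚ
  e j = evalQ η (v j)

  r s : Fin (suc k)
  r = punchIn f zero
  s = punchIn f (proj₁ nonconstant)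

  r≢f : r ≢ f
  r≢f = FinP.punchInᵢ≢i f zero

  L : Fin (suc k) → AffQ n
  L = baryCoord S

  K₁ : ℚ
  K₁ = fromℕ (suc k′)

  0<K₁ : 0ℚ < K₁
  0<K₁ = ℚP.<-≤-trans (ℚP.positive⁻¹ 1ℚ) (1≤fromℕ (suc k′))

  es-er≢0 : e s - e r ≢ 0ℚ
  es-er≢0 es-er≡0 = proj₂ nonconstant (x∙y⁻¹≈ε⇒x≈y (e s) (e r) es-er≡0)

  -- Opaque: normalising rational arithmetic on these constants is hopelessly slow.
  opaque
    A : ℚ
    A = (e r - e f) * (1/ (e s - e r)) {{ℚ.≢-nonZero es-er≢0}}

    -- μ₀ = δ_f + A δ_s + B δ_r with A + B = - 1 has zero sum, and A is chosen to make
    -- μ₀ orthogonal to the vertex values e of η.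
    μ₀ : Fin (suc k) → ℚ
    μ₀ = lincomb (1ℚ ∷ A ∷ (- 1ℚ - A) ∷ []) (δ f ∷ δ s ∷ δ r ∷ [])

    dot-μ₀ : ∀ a → dot μ₀ a ≡ 1ℚ * a f + (A * a s + ((- 1ℚ - A) * a r + 0ℚ))
    dot-μ₀ a = trans (dot-lincombˡ (1ℚ ∷ A ∷ (- 1ℚ - A) ∷ []) (δ f ∷ δ s ∷ δ r ∷ []) a)
      (cong₂ (λ p q → 1ℚ * p + q) (dot-δ f a)
        (cong₂ (λ p q → A * p + q) (dot-δ s a) (cong (λ p → (- 1ℚ - A) * p + 0ℚ) (dot-δ r a))))

    Σμ₀≡0 : sumF μ₀ ≡ 0ℚ
    Σμ₀≡0 = begin
      sumF μ₀                                          ≡⟨ sumF-cong (λ j → ℚP.*-identityʳ (μ₀ j)) ⟨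
      dot μ₀ (λ _ → 1ℚ)                                ≡⟨ dot-μ₀ (λ _ → 1ℚ) ⟩
      1ℚ * 1ℚ + (A * 1ℚ + ((- 1ℚ - A) * 1ℚ + 0ℚ))      ≡⟨ cancel A ⟩
      0ℚ                                               ∎
      where
      cancel : ∀ A → 1ℚ * 1ℚ + (A * 1ℚ + ((- 1ℚ - A) * 1ℚ + 0ℚ)) ≡ 0ℚ
      cancel = solve 1 (λ A → con 1ℚ :* con 1ℚ :+ (A :* con 1ℚ :+ ((:- con 1ℚ :- A) :* con 1ℚ :+ con 0ℚ)) := con 0ℚ) refl

    μ₀·e≡0 : dot μ₀ e ≡ 0ℚ
    μ₀·e≡0 = begin
      dot μ₀ e                                          ≡⟨ dot-μ₀ e ⟩
      1ℚ * e f + (A * e s + ((- 1ℚ - A) * e r + 0ℚ))    ≡⟨ regroup (e f) (e s) (e r) A ⟩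
      (e f - e r) + A * (e s - e r)                     ≡⟨ cong ((e f - e r) +_) A[es-er] ⟩
      (e f - e r) + (e r - e f)                         ≡⟨ cancel (e f) (e r) ⟩
      0ℚ                                                ∎
      where
      regroup : ∀ ef es er A → 1ℚ * ef + (A * es + ((- 1ℚ - A) * er + 0ℚ)) ≡ (ef - er) + A * (es - er)
      regroup = solve 4 (λ ef es er A → con 1ℚ :* ef :+ (A :* es :+ ((:- con 1ℚ :- A) :* er :+ con 0ℚ)) :=
        (ef :- er) :+ A :* (es :- er)) refl
      cancel : ∀ p q → (p - q) + (q - p) ≡ 0ℚ
      cancel = solve 2 (λ p q → (p :- q) :+ (q :- p) := con 0ℚ) refl
      A[es-er] : A * (e s - e r) ≡ e r - e f
      A[es-er] = trans (ℚP.*-assoc (e r - e f) _ (e s - e r))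
        (trans (cong ((e r - e f) *_) (ℚP.*-inverseˡ (e s - e r) {{ℚ.≢-nonZero es-er≢0}})) (ℚP.*-identityʳ (e r - e f)))

    μ₀-f : μ₀ f ≡ 1ℚ
    μ₀-f = begin
      1ℚ * δ f f + (A * δ s f + ((- 1ℚ - A) * δ r f + 0ℚ))
        ≡⟨ cong₂ (λ p q → 1ℚ * p + (A * q + ((- 1ℚ - A) * δ r f + 0ℚ)))
                 (δ-diag f) (δ-off (FinP.punchInᵢ≢i f (proj₁ nonconstant))) ⟩
      1ℚ * 1ℚ + (A * 0ℚ + ((- 1ℚ - A) * δ r f + 0ℚ))
        ≡⟨ cong (λ w → 1ℚ * 1ℚ + (A * 0ℚ + ((- 1ℚ - A) * w + 0ℚ))) (δ-off r≢f) ⟩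
      1ℚ * 1ℚ + (A * 0ℚ + ((- 1ℚ - A) * 0ℚ + 0ℚ))
        ≡⟨ simplify A ⟩
      1ℚ ∎
      where
      simplify : ∀ A → 1ℚ * 1ℚ + (A * 0ℚ + ((- 1ℚ - A) * 0ℚ + 0ℚ)) ≡ 1ℚ
      simplify = solve 1 (λ A → con 1ℚ :* con 1ℚ :+ (A :* con 0ℚ :+ ((:- con 1ℚ :- A) :* con 0ℚ :+ con 0ℚ)) := con 1ℚ) refl

    Pₙ : ℕ
    Pₙ = commonDenominator μ₀ ℕ.* commonDenominator (comb v μ₀)

    P : ℚ
    P = fromℕ Pₙ

    μ : Fin (suc k) → ℚ
    μ j = P * μ₀ j

    d : Pt n
    d i = P * comb v μ₀ i

    μ-integral : ∀ j → IsInt (μ j)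
    μ-integral j = clears-∣ (μ₀ j) (Divisibility.m∣m*n {commonDenominator μ₀} (commonDenominator (comb v μ₀)))
      (commonDenominator-clears μ₀ j)

    d-integral : ∀ i → IsInt (d i)
    d-integral i = clears-∣ (comb v μ₀ i) (Divisibility.n∣m*n (commonDenominator μ₀) {commonDenominator (comb v μ₀)})
      (commonDenominator-clears (comb v μ₀) i)

    d≋ : d ≋ comb v μ
    d≋ i = sym (trans (sumF-cong (λ j → ℚP.*-assoc P (μ₀ j) (v j i))) (sumF-*ˡ P (λ j → μ₀ j * v j i)))

    Σμ≡0 : sumF μ ≡ 0ℚ
    Σμ≡0 = trans (sumF-*ˡ P μ₀) (trans (cong (P *_) Σμ₀≡0) (ℚP.*-zeroʳ P))

    μ·e≡0 : dot μ e ≡ 0ℚ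
    μ·e≡0 = trans (dot-*ˡ P μ₀ e) (trans (cong (P *_) μ₀·e≡0) (ℚP.*-zeroʳ P))

    0<μ-f : 0ℚ < μ f
    0<μ-f = subst (0ℚ <_) (sym (trans (cong (P *_) μ₀-f) (ℚP.*-identityʳ P)))
      (ℚP.<-≤-trans (ℚP.positive⁻¹ 1ℚ) (1≤fromℕ Pₙ {{Pₙ-nonZero}}))
      where
      Pₙ-nonZero : ℕ.NonZero Pₙ
      Pₙ-nonZero = ℕP.m*n≢0 (commonDenominator μ₀) (commonDenominator (comb v μ₀))
        {{commonDenominator-nonZero μ₀}} {{commonDenominator-nonZero (comb v μ₀)}}

    N₀ : ℕ
    N₀ = ∏ (λ g → denominatorAff (L g))

    N : ℚ
    N = fromℕ (suc k ℕ.* N₀)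

    NL-integral : ∀ g → IntegralAff (N ·ₐ L g)
    NL-integral g = IntegralAff-multiple (L g)
      (Divisibility.∣-trans (∣∏ (λ g → denominatorAff (L g)) g) (Divisibility.n∣m*n (suc k) {N₀}))

    vertices≤N : 1ℚ + (1ℚ + K₁) ≤ N
    vertices≤N = subst (_≤ N) (trans (fromℕ-suc (suc (suc k′))) (cong (1ℚ +_) (fromℕ-suc (suc k′))))
      (fromℕ-mono-≤ (ℕP.m≤m*n (suc k) N₀ {{∏-nonZero _ (λ g → denominatorAff-nonZero (L g))}}))

    M : ℚ
    M = N * sumF (λ j → ∣ μ j ∣)

    M-integral : IsInt M
    M-integral = IsInt-* (IsInt-ℤ (ℤ.+ (suc k ℕ.* N₀))) (IsInt-sumF (λ j → IsInt-∣∣ (μ-integral j)))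

    0<N : 0ℚ < N
    0<N = ℚP.<-≤-trans (0<1+[1+p] (ℚP.<⇒≤ 0<K₁)) vertices≤N

    N∣μ∣≤M : ∀ j → N * ∣ μ j ∣ ≤ M
    N∣μ∣≤M j = ℚP.*-monoˡ-≤-nonNeg N {{ℚ.nonNegative (ℚP.<⇒≤ 0<N)}} (term≤sumF (λ j → ℚP.0≤∣p∣ (μ j)) j)

    0<M : 0ℚ < M
    0<M = ℚP.<-≤-trans (0<* 0<N (subst (0ℚ <_) (sym (ℚP.0≤p⇒∣p∣≡p (ℚP.<⇒≤ 0<μ-f))) 0<μ-f)) (N∣μ∣≤M f)

  -- Λ (suc t) = N L_g - 1 for the vertices g = punchIn f t of the facet opposite f, and
  -- Λ zero = 1 - M (N L_r - 1) caps the hinge by 1/(1 + M).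
  Λ : Fin (suc k) → AffQ n
  Λ zero    = (- M) ·ₐ Λ (suc zero) +ₐ 1ℚ
  Λ (suc t) = N ·ₐ L (punchIn f t) +ₐ (- 1ℚ)

  Λ-integral : ∀ i → IntegralAff (Λ i)
  Λ-integral zero    = IntegralAff-+ₐ ((- M) ·ₐ Λ (suc zero)) 1ℚ
    (IntegralAff-·ₐ (- M) (Λ (suc zero)) (IsInt-neg M-integral) (Λ-integral (suc zero))) (IsInt-ℤ ℤ.1ℤ)
  Λ-integral (suc t) = IntegralAff-+ₐ (N ·ₐ L (punchIn f t)) (- 1ℚ)
    (NL-integral (punchIn f t)) (IsInt-neg (IsInt-ℤ ℤ.1ℤ))

  module _ (c : Fin (suc k) → ℚ) {x} (Σc≡1 : sumF c ≡ 1ℚ) (x≋ : x ≋ comb v c) where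

    Λ-suc-at : ∀ t → evalQ (Λ (suc t)) x ≡ N * c (punchIn f t) - 1ℚ
    Λ-suc-at t = trans (evalQ-+ₐ (N ·ₐ L (punchIn f t)) (- 1ℚ) x)
      (cong (_- 1ℚ) (trans (evalQ-·ₐ N (L (punchIn f t)) x) (cong (N *_) (baryCoord-comb S (punchIn f t) c Σc≡1 x x≋))))

    Λ-zero-at : evalQ (Λ zero) x ≡ - M * (N * c r - 1ℚ) + 1ℚ
    Λ-zero-at = trans (evalQ-+ₐ ((- M) ·ₐ Λ (suc zero)) 1ℚ x)
      (cong (_+ 1ℚ) (trans (evalQ-·ₐ (- M) (Λ (suc zero)) x) (cong (- M *_) (Λ-suc-at zero))))

  ρ : ZMap n n
  ρ = shearZMap Λ Λ-integral d d-integral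

  fixes-facets : ∀ g → g ≢ f → ∀ x → InFacet S g x → shear Λ d x ≋ x
  fixes-facets g g≢f x (c , (_ , Σc≡1) , c-g≡0 , x≋) = shear-unmoved Λ d x (hinge-vanishes Λ x (suc t) Λ≤0)
    where
    t : Fin k
    t = Fin.punchOut (g≢f ∘ sym)
    c-t≡0 : c (punchIn f t) ≡ 0ℚ
    c-t≡0 = trans (cong c (FinP.punchIn-punchOut (g≢f ∘ sym))) c-g≡0
    minus-one : ∀ N → N * 0ℚ - 1ℚ ≡ - 1ℚ
    minus-one = solve 1 (λ N → N :* con 0ℚ :- con 1ℚ := :- con 1ℚ) refl
    Λ≤0 : evalQ (Λ (suc t)) x ≤ 0ℚ
    Λ≤0 = subst (_≤ 0ℚ) (sym (trans (Λ-suc-at c Σc≡1 x≋ t) (trans (cong (λ p → N * p - 1ℚ) c-t≡0) (minus-one N))))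
            (ℚP.neg-antimono-≤ (ℚP.<⇒≤ (ℚP.positive⁻¹ 1ℚ)))

  η-flat-along-d : dot (AffQ.coeff η) d ≡ 0ℚ
  η-flat-along-d = begin
    dot (AffQ.coeff η) d            ≡⟨ sumF-cong (λ i → cong (AffQ.coeff η i *_) (d≋ i)) ⟩
    dot (AffQ.coeff η) (comb v μ)   ≡⟨ coeff-comb-zeroSum η v μ Σμ≡0 ⟩
    dot μ e                         ≡⟨ μ·e≡0 ⟩
    0ℚ                              ∎

  preserves-η : ∀ x → evalQ η (shear Λ d x) ≡ evalQ η x
  preserves-η x = begin
    evalQ η (shear Λ d x)                           ≡⟨ evalQ-translate η x d (hinge Λ x) ⟩
    evalQ η x + hinge Λ x * dot (AffQ.coeff η) d    ≡⟨ cong (λ p → evalQ η x + hinge Λ x * p) η-flat-along-d ⟩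
    evalQ η x + hinge Λ x * 0ℚ                      ≡⟨ cong (evalQ η x +_) (ℚP.*-zeroʳ (hinge Λ x)) ⟩
    evalQ η x + 0ℚ                                  ≡⟨ ℚP.+-identityʳ (evalQ η x) ⟩
    evalQ η x                                       ∎

  shifted-sum : ∀ (c : Fin (suc k) → ℚ) h → sumF c ≡ 1ℚ → sumF (λ j → c j + h * μ j) ≡ 1ℚ
  shifted-sum c h Σc≡1 = begin
    sumF (λ j → c j + h * μ j)        ≡⟨ sumF-+ c (λ j → h * μ j) ⟩
    sumF c + sumF (λ j → h * μ j)
      ≡⟨ cong₂ _+_ Σc≡1 (trans (sumF-*ˡ h μ) (trans (cong (h *_) Σμ≡0) (ℚP.*-zeroʳ h))) ⟩
    1ℚ + 0ℚ                           ≡⟨⟩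
    1ℚ                                ∎

  maps-into : ZMapInto S ρ
  maps-into x (c , (c≥0 , Σc≡1) , x≋) =
    (λ j → c j + h * μ j) , (shifted≥0 , shifted-sum c h Σc≡1) , comb-translate v c μ h x≋ d≋
    where
    h : ℚ
    h = hinge Λ x
    at-f : 0ℚ ≤ c f + h * μ f
    at-f = ℚP.+-mono-≤ (c≥0 f) (0≤* (hinge-nonNeg Λ x) (ℚP.<⇒≤ 0<μ-f))
    at-facet : (∀ i → h ≤ evalQ (Λ i) x) → ∀ t → 0ℚ ≤ c (punchIn f t) + h * μ (punchIn f t)
    at-facet h≤Λ t = squeeze-nonNeg 0<N (N∣μ∣≤M (punchIn f t)) (hinge-nonNeg Λ x)
      (subst (h ≤_) (Λ-suc-at c Σc≡1 x≋ t) (h≤Λ (suc t)))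
      (subst (h ≤_) (Λ-suc-at c Σc≡1 x≋ zero) (h≤Λ (suc zero)))
      (subst (h ≤_) (Λ-zero-at c Σc≡1 x≋) (h≤Λ zero))
    unmoved : h ≡ 0ℚ → ∀ j → 0ℚ ≤ c j + h * μ j
    unmoved h≡0 j = subst (0ℚ ≤_) (sym (trans (cong (λ p → c j + p * μ j) h≡0)
      (trans (cong (c j +_) (ℚP.*-zeroˡ (μ j))) (ℚP.+-identityʳ (c j))))) (c≥0 j)
    moved : (∀ i → h ≤ evalQ (Λ i) x) → ∀ j → 0ℚ ≤ c j + h * μ j
    moved h≤Λ j = [ (λ f≡j → subst (λ j → 0ℚ ≤ c j + h * μ j) f≡j at-f)
                  , (λ { (t , refl) → at-facet h≤Λ t }) ]′ (punchIn-cover f j)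
    shifted≥0 : ∀ j → 0ℚ ≤ c j + h * μ j
    shifted≥0 j = [ (λ h≡0 → unmoved h≡0 j) , (λ h≤Λ → moved h≤Λ j) ]′ (hinge-bounded Λ x)

  0<Np-1⇒0<p : ∀ {p} → 0ℚ < N * p - 1ℚ → 0ℚ < p
  0<Np-1⇒0<p {p} 0<Np-1 = 0<N*p⇒0<p 0<N (subst (0ℚ <_) (restore (N * p))
    (ℚP.+-mono-<-≤ 0<Np-1 (ℚP.<⇒≤ (ℚP.positive⁻¹ 1ℚ))))
    where
    restore : ∀ q → q - 1ℚ + 1ℚ ≡ q
    restore = solve 1 (λ q → q :- con 1ℚ :+ con 1ℚ := q) refl

  weights : ∃[ α ] ∃[ β ]
    (α + K₁ * β ≡ 1ℚ × 0ℚ < N * α - 1ℚ × 0ℚ < - M * (N * α - 1ℚ) + 1ℚ × 0ℚ < N * β - 1ℚ)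
  weights = interiorWeights 0<M 0<K₁ vertices≤N

  α β : ℚ
  α = proj₁ weights
  β = proj₁ (proj₂ weights)

  0<Nα-1 : 0ℚ < N * α - 1ℚ
  0<Nα-1 = proj₁ (proj₂ (proj₂ (proj₂ weights)))

  0<cap : 0ℚ < - M * (N * α - 1ℚ) + 1ℚ
  0<cap = proj₁ (proj₂ (proj₂ (proj₂ (proj₂ weights))))

  0<Nβ-1 : 0ℚ < N * β - 1ℚ
  0<Nβ-1 = proj₂ (proj₂ (proj₂ (proj₂ (proj₂ weights))))

  -- A point of the facet opposite f at which every Λ i is positive: it is not in the image.
  y : Fin (suc k) → ℚ
  y j = β + lincomb (α - β ∷ - β ∷ []) (δ r ∷ δ f ∷ []) j

  Σy≡1 : sumF y ≡ 1ℚ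
  Σy≡1 = begin
    sumF y
      ≡⟨ sumF-+ (λ _ → β) (lincomb (α - β ∷ - β ∷ []) (δ r ∷ δ f ∷ [])) ⟩
    sumF {suc k} (λ _ → β) + sumF (lincomb (α - β ∷ - β ∷ []) (δ r ∷ δ f ∷ []))
      ≡⟨ cong₂ _+_ (sumF-const {suc k} β)
                   (sym (sumF-cong (λ j → ℚP.*-identityʳ (lincomb (α - β ∷ - β ∷ []) (δ r ∷ δ f ∷ []) j)))) ⟩
    fromℕ (suc k) * β + dot (lincomb (α - β ∷ - β ∷ []) (δ r ∷ δ f ∷ [])) (λ _ → 1ℚ)
      ≡⟨ cong₂ (λ p q → p * β + q) vertices
           (trans (dot-lincombˡ (α - β ∷ - β ∷ []) (δ r ∷ δ f ∷ []) (λ _ → 1ℚ))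
                  (cong₂ (λ p q → (α - β) * p + (- β * q + 0ℚ)) (dot-δ r (λ _ → 1ℚ)) (dot-δ f (λ _ → 1ℚ)))) ⟩
    (1ℚ + (1ℚ + K₁)) * β + ((α - β) * 1ℚ + (- β * 1ℚ + 0ℚ))
      ≡⟨ collect α β K₁ ⟩
    α + K₁ * β
      ≡⟨ proj₁ (proj₂ (proj₂ weights)) ⟩
    1ℚ ∎
    where
    vertices : fromℕ (suc k) ≡ 1ℚ + (1ℚ + K₁)
    vertices = trans (fromℕ-suc (suc (suc k′))) (cong (1ℚ +_) (fromℕ-suc (suc k′)))
    collect : ∀ α β K → (1ℚ + (1ℚ + K)) * β + ((α - β) * 1ℚ + (- β * 1ℚ + 0ℚ)) ≡ α + K * β
    collect = solve 3 (λ α β K → (con 1ℚ :+ (con 1ℚ :+ K)) :* β :+ ((α :- β) :* con 1ℚ :+ (:- β :* con 1ℚ :+ con 0ℚ)) :=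
      α :+ K :* β) refl

  y-f : y f ≡ 0ℚ
  y-f = trans (cong₂ (λ p q → β + ((α - β) * p + (- β * q + 0ℚ))) (δ-off r≢f) (δ-diag f)) (vanish α β)
    where
    vanish : ∀ α β → β + ((α - β) * 0ℚ + (- β * 1ℚ + 0ℚ)) ≡ 0ℚ
    vanish = solve 2 (λ α β → β :+ ((α :- β) :* con 0ℚ :+ (:- β :* con 1ℚ :+ con 0ℚ)) := con 0ℚ) refl

  y-r : y r ≡ α
  y-r = trans (cong₂ (λ p q → β + ((α - β) * p + (- β * q + 0ℚ))) (δ-diag r) (δ-off (r≢f ∘ sym))) (keep α β)
    where
    keep : ∀ α β → β + ((α - β) * 1ℚ + (- β * 0ℚ + 0ℚ)) ≡ α
    keep = solve 2 (λ α β → β :+ ((α :- β) :* con 1ℚ :+ (:- β :* con 0ℚ :+ con 0ℚ)) := α) refl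

  y-other : ∀ {g} → g ≢ f → g ≢ r → y g ≡ β
  y-other g≢f g≢r =
    trans (cong₂ (λ p q → β + ((α - β) * p + (- β * q + 0ℚ))) (δ-off (g≢r ∘ sym)) (δ-off (g≢f ∘ sym))) (keep α β)
    where
    keep : ∀ α β → β + ((α - β) * 0ℚ + (- β * 0ℚ + 0ℚ)) ≡ β
    keep = solve 2 (λ α β → β :+ ((α :- β) :* con 0ℚ :+ (:- β :* con 0ℚ :+ con 0ℚ)) := β) refl

  y≥0 : ∀ j → 0ℚ ≤ y j
  y≥0 j = by-cases (f Fin.≟ j) (r Fin.≟ j)
    where
    by-cases : Dec (f ≡ j) → Dec (r ≡ j) → 0ℚ ≤ y j
    by-cases (yes f≡j) _         = subst (λ j → 0ℚ ≤ y j) f≡j (ℚP.≤-reflexive (sym y-f))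
    by-cases (no _)    (yes r≡j) =
      subst (λ j → 0ℚ ≤ y j) r≡j (subst (0ℚ ≤_) (sym y-r) (ℚP.<⇒≤ (0<Np-1⇒0<p 0<Nα-1)))
    by-cases (no f≢j)  (no r≢j)  =
      subst (0ℚ ≤_) (sym (y-other (f≢j ∘ sym) (r≢j ∘ sym))) (ℚP.<⇒≤ (0<Np-1⇒0<p 0<Nβ-1))

  Λ-positive-at-y : ∀ x → x ≋ comb v y → ∀ i → 0ℚ < evalQ (Λ i) x
  Λ-positive-at-y x x≋ zero =
    subst (0ℚ <_) (sym (trans (Λ-zero-at y Σy≡1 x≋) (cong (λ p → - M * (N * p - 1ℚ) + 1ℚ) y-r))) 0<cap
  Λ-positive-at-y x x≋ (suc t) = subst (0ℚ <_) (sym (Λ-suc-at y Σy≡1 x≋ t)) (by-cases (t Fin.≟ zero))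
    where
    by-cases : Dec (t ≡ zero) → 0ℚ < N * y (punchIn f t) - 1ℚ
    by-cases (yes t≡0) = subst (λ t → 0ℚ < N * y (punchIn f t) - 1ℚ) (sym t≡0)
                           (subst (λ p → 0ℚ < N * p - 1ℚ) (sym y-r) 0<Nα-1)
    by-cases (no t≢0)  = subst (λ p → 0ℚ < N * p - 1ℚ)
                           (sym (y-other (FinP.punchInᵢ≢i f t) (t≢0 ∘ FinP.punchIn-injective f t zero))) 0<Nβ-1

  no-preimage : ¬ (∃[ x ] (InS S x × shear Λ d x ≋ comb v y))
  no-preimage (x , (c , (c≥0 , Σc≡1) , x≋) , ρx≋y) = [ moved , unmoved ]′ (0≤⇒0<⊎≡0 (hinge-nonNeg Λ x))
    where
    h : ℚ
    h = hinge Λ x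
    f-coordinate≡0 : c f + h * μ f ≡ 0ℚ
    f-coordinate≡0 = trans (sym (baryCoord-comb S f (λ j → c j + h * μ j) (shifted-sum c h Σc≡1) (shear Λ d x)
                                  (comb-translate v c μ h x≋ d≋)))
                           (trans (baryCoord-comb S f y Σy≡1 (shear Λ d x) ρx≋y) y-f)
    moved : ¬ (0ℚ < h)
    moved 0<h = ℚP.<-irrefl refl (subst (0ℚ <_) f-coordinate≡0 (ℚP.+-mono-≤-< (c≥0 f) (0<* 0<h 0<μ-f)))
    unmoved : ¬ (h ≡ 0ℚ)
    unmoved h≡0 = ℚP.<-irrefl (sym h≡0) (hinge-pos Λ x (Λ-positive-at-y x x≋y))
      where
      x≋y : x ≋ comb v y
      x≋y i = trans (sym (shear-unmoved Λ d x h≡0 i)) (ρx≋y i)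

  not-surjective : ¬ SurjOnS S ρ
  not-surjective surj = no-preimage (surj (comb v y) (y , (y≥0 , Σy≡1) , λ _ → refl))

lemma4p5 : (k n : ℕ) → 2 ℕ.≤ k → (S : RSimplex k n) → (f : Fin (suc k)) →
    (η : AffZ1 n) →
    (∃[ x ] ∃[ y ] (InFacet S f x × InFacet S f y × ¬ (evalAffZ1 η x ≡ evalAffZ1 η y))) →
    ∃[ ρ ] (ZMapInto S ρ × ¬ SurjOnS S ρ ×
      (∀ x → InS S x → evalAffZ1 η (ZMap.fun ρ x) ≡ evalAffZ1 η x) ×
      (∀ (g : Fin (suc k)) → ¬ (g ≡ f) → ∀ x → InFacet S g x → ZMap.fun ρ x ≋ x))
lemma4p5 zero           n ()         S f η _
lemma4p5 (suc zero)     n (ℕ.s≤s ()) S f η _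
lemma4p5 (suc (suc k′)) n _          S f η η-nonconstant =
  ρ , maps-into , not-surjective , (λ x _ → preserves-η x) , fixes-facets
  where open Squeeze S f (toAffQ η) (nonconstant-on-facet⇒vertices-differ S f (toAffQ η) η-nonconstant)
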